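{- Let $x$ be one of the variables of the working field $K$, and let $$E= \frac{L(x)}{\prod_{i=1}^n (1-u_i x^{a_i})},$$ where $L(x)$ is a Laurent polynomial in $x$ whose coefficients are free of $x$, each $u_i$ is a monomial in the variables other than $x$, each $a_i$ is a positive integer, and the factors $1-u_ix^{a_i}$ are pairwise coprime. Regard $E$ as an element of $K$ and let $\mathrm{CT}_x E$ be its constant term in $x$. (1) If $E$ is a proper rational function in $x$ (the degree in $x$ of the numerator is less than the degree in $x$ of the denominator), then $$\mathrm{CT}_x E= \sum_{i=1}^n \chi(u_ix^{a_i}<1)\, \langle E, 1-u_i x^{a_i}|_x .$$ (2) If $E|_{x=0}$ exists (i.e. $E$ has no pole at $x=0$), then $$\mathrm{CT}_x E =E|_{x=0}- \sum_{i=1}^n \chi(u_ix^{a_i}>1)\, \langle E, 1-u_i x^{a_i}|_x.$$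
   Context: Working field: for an ordered list of variables $[x_1,\dots,x_N]$, $K=\mathbb{Q}((x_N))((x_{N-1}))\cdots((x_1))$ is the field of iterated Laurent series. A monomial $M\neq 1$ is compared with $1$ as follows: let $x_j$ be the variable of smallest index appearing in $M$; if $\deg_{x_j}M>0$ then $M<1$ (small), otherwise $M>1$ (large). Accordingly, in $K$, $\frac{1}{1-M}=\sum_{k\ge0}M^k$ if $M<1$ and $\frac{1}{1-M}=-\sum_{k\ge 0}M^{ -k-1}$ if $M>1$; this determines the expansion of $E$ in $K$, and $\mathrm{CT}_x E$ is the coefficient of $x^0$ in this expansion. $\chi(S)$ is $1$ if the statement $S$ is true and $0$ otherwise. Write the partial fraction decomposition of $E$ in $x$ as $E=P(x)+p(x)/x^k+\sum_{i=1}^n \frac{A_i(x)}{1-u_ix^{a_i}}$ with $P,p,A_i$ polynomials in $x$, $\deg p<k$, $\deg A_i<a_i$. Then $\langle E, 1-u_i x^{a_i}|_x := A_i(0)$ (the contribution of the denominator factor $1-u_ix^{a_i}$). -}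

module Defs where

open import Data.Nat as ℕ using (ℕ; zero; suc)
open import Data.Integer as ℤ using (ℤ; +_; -[1+_]; +[1+_])
open import Data.Rational as ℚ using (ℚ; 0ℚ; 1ℚ)
open import Data.Rational.Properties as ℚP using ()
open import Data.Vec as V using (Vec; []; _∷_; lookup; _[_]≔_; replicate; zipWith)
open import Data.Vec.Properties using (≡-dec)
open import Data.Fin as F using (Fin)
open import Data.Fin.Properties as FP using ()
open import Data.List as L using (List; []; _∷_; _++_; concatMap)
open import Data.Product using (Σ; ∃; _×_; _,_)
open import Data.Bool using (Bool; true; false; if_then_else_)
open import Data.Unit using (⊤)
open import Relation.Nullary using (¬_)
open import Relation.Nullary.Decidable using (⌊_⌋)
open import Relation.Binary.PropositionalEquality using (_≡_; _≢_)

-- Variables x_1,…,x_N are indexed by Fin N (index 0 = x_1, the outermost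
-- variable of K = ℚ((x_N))…((x_1))).  Exponent vectors:

Exp : ℕ → Set
Exp N = Vec ℤ N

addE subE : ∀ {N} → Exp N → Exp N → Exp N
addE = zipWith ℤ._+_
subE = zipWith ℤ._-_

0E : ∀ {N} → Exp N
0E = replicate _ (+ 0)

-- Laurent polynomials in x_1..x_N over ℚ, as (not necessarily
-- normalised) finite lists of terms; only `coeff` is meaningful.

LPoly : ℕ → Set
LPoly N = List (ℚ × Exp N)

coeff : ∀ {N} → LPoly N → Exp N → ℚ
coeff [] β = 0ℚ
coeff ((q , m) ∷ p) β =
  (if ⌊ ≡-dec ℤ._≟_ m β ⌋ then q else 0ℚ) ℚ.+ coeff p β

_≈_ : ∀ {N} → LPoly N → LPoly N → Set
p ≈ q = ∀ β → coeff p β ≡ coeff q β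

mono : ∀ {N} → ℚ → Exp N → LPoly N
mono q m = (q , m) ∷ []

one : ∀ {N} → LPoly N
one = mono 1ℚ 0E

_⊕_ : ∀ {N} → LPoly N → LPoly N → LPoly N
_⊕_ = _++_

neg : ∀ {N} → LPoly N → LPoly N
neg = L.map (λ { (q , m) → (ℚ.- q , m) })

_⊗_ : ∀ {N} → LPoly N → LPoly N → LPoly N
p ⊗ r = concatMap (λ { (q , m) → L.map (λ { (q' , m') → (q ℚ.* q' , addE m m') }) r }) p

infixl 6 _⊕_
infixl 7 _⊗_
infix 4 _≈_

sumP : ∀ {N} (n : ℕ) → (Fin n → LPoly N) → LPoly N
sumP zero    f = []
sumP (suc n) f = f F.zero ⊕ sumP n (λ i → f (F.suc i))

prodP : ∀ {N} (n : ℕ) → (Fin n → LPoly N) → LPoly N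
prodP zero    f = one
prodP (suc n) f = f F.zero ⊗ prodP n (λ i → f (F.suc i))

xpow : ∀ {N} → Fin N → ℕ → LPoly N
xpow j k = mono 1ℚ (0E [ j ]≔ + k)

Nonzero : ∀ {N} → LPoly N → Set
Nonzero p = ∃ λ β → coeff p β ≢ 0ℚ

FreeOf : ∀ {N} → Fin N → LPoly N → Set
FreeOf j p = ∀ β → coeff p β ≢ 0ℚ → lookup β j ≡ + 0

PolyIn : ∀ {N} → Fin N → LPoly N → Set
PolyIn j p = ∀ β → coeff p β ≢ 0ℚ → + 0 ℤ.≤ lookup β j

DegLt : ∀ {N} → Fin N → LPoly N → ℤ → Set
DegLt j p d = ∀ β → coeff p β ≢ 0ℚ → lookup β j ℤ.< d

sumℚ : (n : ℕ) → (Fin n → ℚ) → ℚ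
sumℚ zero    f = 0ℚ
sumℚ (suc n) f = f F.zero ℚ.+ sumℚ n (λ i → f (F.suc i))

sumℕ : (n : ℕ) → (Fin n → ℕ) → ℕ
sumℕ zero    f = 0
sumℕ (suc n) f = f F.zero ℕ.+ sumℕ n (λ i → f (F.suc i))

-- Comparison of a monomial (exponent vector) with 1: look at the first
-- (smallest-index) variable occurring.

isSmall : ∀ {N} → Exp N → Bool
isSmall [] = false
isSmall (+ 0 ∷ v) = isSmall v
isSmall (+[1+ _ ] ∷ v) = true
isSmall (-[1+ _ ] ∷ v) = false

isLarge : ∀ {N} → Exp N → Bool
isLarge [] = false
isLarge (+ 0 ∷ v) = isLarge v
isLarge (+[1+ _ ] ∷ v) = false
isLarge (-[1+ _ ] ∷ v) = true

χ : Bool → ℚ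
χ b = if b then 1ℚ else 0ℚ

-- Elements of K = ℚ((x_N))…((x_1)) as coefficient functions with the
-- iterated-Laurent support condition (x_1 outermost).

Ser : ℕ → Set
Ser N = Exp N → ℚ

InK : ∀ {N} → Ser N → Set
InK {zero}  f = ⊤
InK {suc N} f =
  (∃ λ b → ∀ e vs → f (e ∷ vs) ≢ 0ℚ → b ℤ.≤ e)
  × (∀ e → InK {N} (λ vs → f (e ∷ vs)))

-- Laurent polynomial times element of K (coefficientwise finite)
act : ∀ {N} → LPoly N → Ser N → Ser N
act [] f β = 0ℚ
act ((q , m) ∷ p) f β = q ℚ.* f (subE β m) ℚ.+ act p f β

-- The setting of Lemma 4.1.  x = x_j; u i exponent vector of u_i
-- (free of x_j); a i = a_i.

uxa : ∀ {N n} → Fin N → (Fin n → Exp N) → (Fin n → ℕ) → Fin n → Exp N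
uxa j u a i = u i [ j ]≔ + a i

Fac : ∀ {N n} → Fin N → (Fin n → Exp N) → (Fin n → ℕ) → Fin n → LPoly N
Fac j u a i = one ⊕ neg (mono 1ℚ (uxa j u a i))

Den : ∀ {N} → Fin N → (n : ℕ) → (Fin n → Exp N) → (Fin n → ℕ) → LPoly N
Den j n u a = prodP n (Fac j u a)

DenExcept : ∀ {N} → Fin N → (n : ℕ) → (Fin n → Exp N) → (Fin n → ℕ) → Fin n → LPoly N
DenExcept j n u a i = prodP n (λ i' → if ⌊ i FP.≟ i' ⌋ then one else Fac j u a i')

-- f and g coprime in ℚ(other variables)[x_j] (Bézout, denominators cleared)
CoprimeIn : ∀ {N} → Fin N → LPoly N → LPoly N → Set
CoprimeIn {N} j f g = Σ (LPoly N) λ s → Σ (LPoly N) λ t → Σ (LPoly N) λ d →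
  PolyIn j s × PolyIn j t × FreeOf j d × Nonzero d × (s ⊗ f ⊕ t ⊗ g ≈ d)

-- f is the expansion in K of E = Nm / (c · ∏(1 - u_i x^{a_i})),
-- i.e. the (unique) element of K with (c · Den) · f = Nm.
IsExpansion : ∀ {N} → Fin N → (n : ℕ) → (Fin n → Exp N) → (Fin n → ℕ) →
              LPoly N → LPoly N → Ser N → Set
IsExpansion j n u a Nm c f =
  InK f × (∀ β → act (c ⊗ Den j n u a) f β ≡ coeff Nm β)

-- Partial fraction decomposition of E = Nm/(c·Den) in x_j with all
-- pieces scaled by a common nonzero x-free denominator D:
--   E = P/D + (p/D)/x^k + Σ_i (B i / D)/(1 - u_i x^{a_i}),
-- P, p, B i polynomials in x_j, deg p < k, deg B i < a_i.
-- So A_i = B i / D and ⟨E, 1 - u_i x^{a_i}|_x = A_i(0).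
IsPartialFraction : ∀ {N} → Fin N → (n : ℕ) → (Fin n → Exp N) → (Fin n → ℕ) →
  LPoly N → LPoly N →
  (D : LPoly N) (k : ℕ) (P p : LPoly N) (B : Fin n → LPoly N) → Set
IsPartialFraction j n u a Nm c D k P p B =
  FreeOf j D × Nonzero D ×
  PolyIn j P × PolyIn j p × DegLt j p (+ k) ×
  (∀ i → PolyIn j (B i) × DegLt j (B i) (+ a i)) ×
  (xpow j k ⊗ D ⊗ Nm ≈
     c ⊗ ((xpow j k ⊗ P ⊕ p) ⊗ Den j n u a
          ⊕ xpow j k ⊗ sumP n (λ i → B i ⊗ DenExcept j n u a i)))

{-# OPTIONS --safe #-}
-- Laurent polynomials act on coefficient functions by convolution, and on
-- the iterated Laurent series field K this action has no zero divisors (peel off the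
-- lowest slice in the outermost variable and recurse).  Hence the expansion f is pinned
-- down by c · ∏ (1 - u_i x^{a_i}) · f = Nm, and the partial fraction identity shows that
-- D f = P + p x^{-k} + Σ_i B_i g_i, where g_i is the expansion in K of 1/(1 - u_i x^{a_i}):
-- Σ_k M^k if M = u_i x^{a_i} is small and - Σ_k M^{-k-1} if it is large.  On the slice x^0
-- the term p x^{-k} vanishes because deg p < k, and B_i g_i contributes χ(M < 1) B_i
-- because deg B_i < a_i.  In case (1) comparing top x-degrees in the partial fraction
-- identity forces P = 0.  In case (2) comparing bottom x-degrees forces p = 0; then
-- the identity at x = 0, where every factor 1 - u_i x^{a_i} is 1, reads
-- D Nm(0) = c (P(0) + Σ_i B_i(0)), and χ(M < 1) + χ(M > 1) = 1 splits the sum.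
module Submission where

open import Defs
open import Data.Nat as ℕ using (ℕ; zero; suc)
import Data.Nat.Properties as ℕP
open import Data.Nat.Induction using (<-rec)
open import Data.Nat.DivMod using (m*n/n≡m)
open import Data.Integer as ℤ using (ℤ; +_; -[1+_]; +[1+_])
import Data.Integer.Properties as ℤP
open import Data.Integer.Tactic.RingSolver using (solve-∀; solve)
open import Data.Rational as ℚ using (ℚ; 0ℚ; 1ℚ; _+_; _*_; -_; _-_)
import Data.Rational.Properties as ℚP
open import Algebra.Bundles using (CommutativeMonoid)
open import Algebra.Properties.CommutativeSemigroup
  (CommutativeMonoid.commutativeSemigroup ℚP.+-0-commutativeMonoid)
  using () renaming (interchange to +-interchange)
open import Data.Vec as V using ([]; _∷_; lookup; _[_]≔_)
open import Data.Vec.Properties using (≡-dec; lookup-zipWith; lookup-replicate; lookup-map; lookup∘update)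
open import Data.Fin as F using (Fin)
import Data.Fin.Properties as FP
open import Data.List as L using (List; []; _∷_)
open import Data.List.Relation.Unary.Any as Any using (here; there; any?)
open import Data.List.Membership.Propositional using (_∈_; lose)
open import Data.List.Membership.Propositional.Properties using (∈-map⁺; ∈-upTo⁺)
open import Data.Product using (Σ; ∃; _×_; _,_; proj₁; proj₂)
open import Data.Bool using (Bool; true; false; if_then_else_)
open import Data.Sum using (_⊎_; inj₁; inj₂)
open import Data.Unit using (tt)
open import Relation.Nullary using (¬_; yes; no; Dec; ¬?; contradiction)
open import Relation.Nullary.Decidable using (⌊_⌋; decidable-stable)
open import Relation.Binary.PropositionalEquality
open import Data.Rational.Solver using (module +-*-Solver)
open +-*-Solver using (_:+_; _:*_; :-_; _:-_; _:=_; con) renaming (solve to ℚ-solve)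

if-yes : ∀ {P A : Set} (d : Dec P) {x y : A} → P → (if ⌊ d ⌋ then x else y) ≡ x
if-yes (yes _) _ = refl
if-yes (no ¬p) p = contradiction p ¬p

if-no : ∀ {P A : Set} (d : Dec P) {x y : A} → ¬ P → (if ⌊ d ⌋ then x else y) ≡ y
if-no (yes p) ¬p = contradiction p ¬p
if-no (no _) _ = refl

i-j+j≡i : ∀ i j → i ℤ.- j ℤ.+ j ≡ i
i-j+j≡i = solve-∀

i+j-j≡i : ∀ i j → i ℤ.+ j ℤ.- j ≡ i
i+j-j≡i = solve-∀

i+j-i≡j : ∀ i j → i ℤ.+ j ℤ.- i ≡ j
i+j-i≡j = solve-∀

i<j⇒i≤j-1 : ∀ {i j} → i ℤ.< j → i ℤ.≤ j ℤ.- + 1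
i<j⇒i≤j-1 {i} {j} i<j =
  subst (ℤ._≤ j ℤ.- + 1) (i+j-i≡j (+ 1) i) (ℤP.+-monoˡ-≤ (ℤ.- + 1) (ℤP.i<j⇒suc[i]≤j i<j))

+-congˡ : ∀ x {y z : ℚ} → y ≡ z → x + y ≡ x + z
+-congˡ x = cong (λ v → x + v)

≡0-stable : ∀ (x : ℚ) → ¬ ¬ (x ≡ 0ℚ) → x ≡ 0ℚ
≡0-stable x = decidable-stable (x ℚP.≟ 0ℚ)

x+y≢0⇒x≢0⊎y≢0 : ∀ x y → x + y ≢ 0ℚ → x ≢ 0ℚ ⊎ y ≢ 0ℚ
x+y≢0⇒x≢0⊎y≢0 x y x+y≢0 with x ℚP.≟ 0ℚ
... | no x≢0 = inj₁ x≢0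
... | yes refl = inj₂ (λ y≡0 → x+y≢0 (trans (ℚP.+-identityˡ y) y≡0))

x*y≢0⇒y≢0 : ∀ x y → x * y ≢ 0ℚ → y ≢ 0ℚ
x*y≢0⇒y≢0 x y x*y≢0 refl = x*y≢0 (ℚP.*-zeroʳ x)

-x≢0⇒x≢0 : ∀ x → - x ≢ 0ℚ → x ≢ 0ℚ
-x≢0⇒x≢0 x -x≢0 refl = -x≢0 refl

x*y≡0⇒y≡0 : ∀ x y → x ≢ 0ℚ → x * y ≡ 0ℚ → y ≡ 0ℚ
x*y≡0⇒y≡0 x y x≢0 xy≡0 = begin
  y                     ≡⟨ sym (ℚP.*-identityˡ y) ⟩
  1ℚ * y                ≡⟨ cong (_* y) (sym (ℚP.*-inverseˡ x)) ⟩
  ℚ.1/ x * x * y        ≡⟨ ℚP.*-assoc (ℚ.1/ x) x y ⟩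
  ℚ.1/ x * (x * y)      ≡⟨ cong (ℚ.1/ x *_) xy≡0 ⟩
  ℚ.1/ x * 0ℚ           ≡⟨ ℚP.*-zeroʳ (ℚ.1/ x) ⟩
  0ℚ                    ∎
  where
  open ≡-Reasoning
  instance _ = ℚ.≢-nonZero x≢0

x*y≢0 : ∀ x y → x ≢ 0ℚ → y ≢ 0ℚ → x * y ≢ 0ℚ
x*y≢0 x y x≢0 y≢0 xy≡0 = y≢0 (x*y≡0⇒y≡0 x y x≢0 xy≡0)

subE-identityʳ : ∀ {N} (β : Exp N) → subE β 0E ≡ β
subE-identityʳ [] = refl
subE-identityʳ (x ∷ β) = cong₂ _∷_ (ℤP.+-identityʳ x) (subE-identityʳ β)

subE-addE : ∀ {N} (β m m' : Exp N) → subE β (addE m m') ≡ subE (subE β m) m'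
subE-addE [] [] [] = refl
subE-addE (x ∷ β) (y ∷ m) (z ∷ m') = cong₂ _∷_ (solve (x L.∷ y L.∷ z L.∷ L.[])) (subE-addE β m m')

subE-subE-comm : ∀ {N} (β m m' : Exp N) → subE (subE β m) m' ≡ subE (subE β m') m
subE-subE-comm [] [] [] = refl
subE-subE-comm (x ∷ β) (y ∷ m) (z ∷ m') = cong₂ _∷_ (solve (x L.∷ y L.∷ z L.∷ L.[])) (subE-subE-comm β m m')

subE-self : ∀ {N} (β : Exp N) → subE β β ≡ 0E
subE-self [] = refl
subE-self (x ∷ β) = cong₂ _∷_ (ℤP.+-inverseʳ x) (subE-self β)

subE≡0E⇒≡ : ∀ {N} (β m : Exp N) → subE β m ≡ 0E → m ≡ β
subE≡0E⇒≡ [] [] _ = refl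
subE≡0E⇒≡ (x ∷ β) (y ∷ m) eq =
  cong₂ _∷_ (sym (ℤP.i-j≡0⇒i≡j x y (cong V.head eq))) (subE≡0E⇒≡ β m (cong V.tail eq))

subE-addE-cancel : ∀ {N} (m μ : Exp N) → subE (addE m μ) μ ≡ m
subE-addE-cancel [] [] = refl
subE-addE-cancel (x ∷ m) (y ∷ μ) = cong₂ _∷_ (i+j-j≡i x y) (subE-addE-cancel m μ)

lookup-subE : ∀ {N} (β m : Exp N) j → lookup (subE β m) j ≡ lookup β j ℤ.- lookup m j
lookup-subE β m j = lookup-zipWith ℤ._-_ j β m

lookup-addE : ∀ {N} (β m : Exp N) j → lookup (addE β m) j ≡ lookup β j ℤ.+ lookup m j
lookup-addE β m j = lookup-zipWith ℤ._+_ j β m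

lookup-0E : ∀ {N} (j : Fin N) → lookup (0E {N}) j ≡ + 0
lookup-0E j = lookup-replicate j (+ 0)

lookup-subE-free : ∀ {N} (γ m : Exp N) j → lookup m j ≡ + 0 → lookup (subE γ m) j ≡ lookup γ j
lookup-subE-free γ m j m≡0 =
  trans (lookup-subE γ m j) (trans (cong (λ z → lookup γ j ℤ.- z) m≡0) (ℤP.+-identityʳ _))

subE-update-cancel : ∀ {N} (j : Fin N) x y β → x ℤ.+ y ≡ + 0 →
  subE (subE β (0E [ j ]≔ x)) (0E [ j ]≔ y) ≡ β
subE-update-cancel F.zero x y (b ∷ β) x+y≡0 =
  cong₂ _∷_ (trans (ℤP.+-assoc b (ℤ.- x) (ℤ.- y))
                   (trans (cong (λ z → b ℤ.+ z) (sym (ℤP.neg-distrib-+ x y)))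
                          (trans (cong (λ z → b ℤ.- z) x+y≡0) (ℤP.+-identityʳ b))))
            (trans (cong (λ z → subE z 0E) (subE-identityʳ β)) (subE-identityʳ β))
subE-update-cancel (F.suc j) x y (b ∷ β) x+y≡0 =
  cong₂ _∷_ (trans (cong (ℤ._- + 0) (ℤP.+-identityʳ b)) (ℤP.+-identityʳ b)) (subE-update-cancel j x y β x+y≡0)

scaleE : ∀ {N} → ℕ → Exp N → Exp N
scaleE k = V.map (+ k ℤ.*_)

negE : ∀ {N} → Exp N → Exp N
negE = V.map (λ z → ℤ.- z)

lookup-scaleE : ∀ {N} k (M : Exp N) j → lookup (scaleE k M) j ≡ + k ℤ.* lookup M j
lookup-scaleE k M j = lookup-map j _ M

scaleE-zero : ∀ {N} (M : Exp N) → scaleE 0 M ≡ 0E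
scaleE-zero [] = refl
scaleE-zero (x ∷ M) = cong₂ _∷_ (ℤP.*-zeroˡ x) (scaleE-zero M)

subE-scaleE-suc : ∀ {N} k (M : Exp N) → subE (scaleE (suc k) M) M ≡ scaleE k M
subE-scaleE-suc k [] = refl
subE-scaleE-suc k (x ∷ M) = cong₂ _∷_
  (trans (cong (λ z → z ℤ.* x ℤ.- x) (ℤP.pos-+ 1 k)) (suc-mul (+ k) x))
  (subE-scaleE-suc k M)
  where
  suc-mul : ∀ t x → (+ 1 ℤ.+ t) ℤ.* x ℤ.- x ≡ t ℤ.* x
  suc-mul = solve-∀

subE≡scaleE : ∀ {N} (β M : Exp N) k → subE β M ≡ scaleE k M → β ≡ scaleE (suc k) M
subE≡scaleE [] [] k eq = refl
subE≡scaleE (b ∷ β) (x ∷ M) k eq = cong₂ _∷_ head-eq (subE≡scaleE β M k (cong V.tail eq))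
  where
  head-eq : b ≡ + suc k ℤ.* x
  head-eq = begin
    b                    ≡⟨ solve (b L.∷ x L.∷ L.[]) ⟩
    (b ℤ.- x) ℤ.+ x      ≡⟨ cong (ℤ._+ x) (cong V.head eq) ⟩
    + k ℤ.* x ℤ.+ x      ≡⟨ mul-suc (+ k) x ⟩
    (+ 1 ℤ.+ + k) ℤ.* x  ≡⟨ cong (ℤ._* x) (sym (ℤP.pos-+ 1 k)) ⟩
    + suc k ℤ.* x        ∎
    where
    open ≡-Reasoning
    mul-suc : ∀ t x → t ℤ.* x ℤ.+ x ≡ (+ 1 ℤ.+ t) ℤ.* x
    mul-suc = solve-∀

subE-negE-subE : ∀ {N} (β M : Exp N) → subE (negE (subE β M)) M ≡ negE β
subE-negE-subE [] [] = refl
subE-negE-subE (b ∷ β) (x ∷ M) = cong₂ _∷_ (solve (b L.∷ x L.∷ L.[])) (subE-negE-subE β M)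

negE≡0E⇒≡0E : ∀ {N} (β : Exp N) → negE β ≡ 0E → β ≡ 0E
negE≡0E⇒≡0E [] _ = refl
negE≡0E⇒≡0E (b ∷ β) eq =
  cong₂ _∷_ (trans (sym (ℤP.neg-involutive b)) (cong (λ z → ℤ.- z) (cong V.head eq)))
            (negE≡0E⇒≡0E β (cong V.tail eq))

negE-0E : ∀ {N} → negE (0E {N}) ≡ 0E
negE-0E {zero} = refl
negE-0E {suc N} = cong₂ _∷_ refl negE-0E

subE-negE≡scaleE : ∀ {N} (β M : Exp N) k → subE (negE β) M ≡ scaleE k M →
  β ≡ addE (negE M) (scaleE k (negE M))
subE-negE≡scaleE [] [] k eq = refl
subE-negE≡scaleE (b ∷ β) (x ∷ M) k eq = cong₂ _∷_ head-eq (subE-negE≡scaleE β M k (cong V.tail eq))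
  where
  head-eq : b ≡ ℤ.- x ℤ.+ + k ℤ.* ℤ.- x
  head-eq = begin
    b                          ≡⟨ solve (b L.∷ x L.∷ L.[]) ⟩
    ℤ.- (ℤ.- b ℤ.- x) ℤ.- x    ≡⟨ cong (λ z → ℤ.- z ℤ.- x) (cong V.head eq) ⟩
    ℤ.- (+ k ℤ.* x) ℤ.- x      ≡⟨ neg-mul (+ k) x ⟩
    ℤ.- x ℤ.+ + k ℤ.* ℤ.- x    ∎
    where
    open ≡-Reasoning
    neg-mul : ∀ t x → ℤ.- (t ℤ.* x) ℤ.- x ≡ ℤ.- x ℤ.+ t ℤ.* ℤ.- x
    neg-mul = solve-∀

addE-identityˡ : ∀ {N} (M : Exp N) → addE 0E M ≡ M
addE-identityˡ [] = refl
addE-identityˡ (x ∷ M) = cong₂ _∷_ (ℤP.+-identityˡ x) (addE-identityˡ M)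

δ : ∀ {N} → Ser N
δ β = if ⌊ ≡-dec ℤ._≟_ β 0E ⌋ then 1ℚ else 0ℚ

δ-0E : ∀ {N} → δ {N} 0E ≡ 1ℚ
δ-0E {N} = if-yes (≡-dec ℤ._≟_ (0E {N}) 0E) refl

δ-≢0E : ∀ {N} {β : Exp N} → β ≢ 0E → δ β ≡ 0ℚ
δ-≢0E β≢0 = if-no (≡-dec ℤ._≟_ _ 0E) β≢0

δ≢0⇒≡0E : ∀ {N} (β : Exp N) → δ β ≢ 0ℚ → β ≡ 0E
δ≢0⇒≡0E β δβ≢0 with ≡-dec ℤ._≟_ β 0E
... | yes β≡0 = β≡0
... | no _ = contradiction refl δβ≢0

δ-negE : ∀ {N} (β : Exp N) → δ (negE β) ≡ δ β
δ-negE β with ≡-dec ℤ._≟_ β 0E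
... | yes refl = trans (cong δ negE-0E) δ-0E
... | no β≢0 = δ-≢0E (λ eq → β≢0 (negE≡0E⇒≡0E β eq))

act-δ : ∀ {N} (p : LPoly N) β → act p δ β ≡ coeff p β
act-δ [] β = refl
act-δ ((a , m) ∷ p) β = cong₂ _+_ term (act-δ p β)
  where
  term : a * δ (subE β m) ≡ (if ⌊ ≡-dec ℤ._≟_ m β ⌋ then a else 0ℚ)
  term with ≡-dec ℤ._≟_ m β
  ... | yes refl = trans (cong (a *_) (trans (cong δ (subE-self m)) δ-0E)) (ℚP.*-identityʳ a)
  ... | no m≢β = trans (cong (a *_) (δ-≢0E (λ eq → m≢β (subE≡0E⇒≡ β m eq)))) (ℚP.*-zeroʳ a)

act-cong : ∀ {N} (p : LPoly N) {F G : Ser N} → (∀ β → F β ≡ G β) → ∀ β → act p F β ≡ act p G β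
act-cong [] F≗G β = refl
act-cong ((a , m) ∷ p) F≗G β = cong₂ _+_ (cong (a *_) (F≗G (subE β m))) (act-cong p F≗G β)

act-⊕ : ∀ {N} (p q : LPoly N) F β → act (p ⊕ q) F β ≡ act p F β + act q F β
act-⊕ [] q F β = sym (ℚP.+-identityˡ _)
act-⊕ ((a , m) ∷ p) q F β =
  trans (+-congˡ (a * F (subE β m)) (act-⊕ p q F β)) (sym (ℚP.+-assoc (a * F (subE β m)) (act p F β) (act q F β)))

act-zeroʳ : ∀ {N} (p : LPoly N) β → act p (λ _ → 0ℚ) β ≡ 0ℚ
act-zeroʳ [] β = refl
act-zeroʳ ((a , m) ∷ p) β = trans (cong₂ _+_ (ℚP.*-zeroʳ a) (act-zeroʳ p β)) (ℚP.+-identityʳ 0ℚ)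

act-+ : ∀ {N} (p : LPoly N) F G β → act p (λ γ → F γ + G γ) β ≡ act p F β + act p G β
act-+ [] F G β = refl
act-+ ((a , m) ∷ p) F G β =
  trans (cong₂ _+_ (ℚP.*-distribˡ-+ a (F (subE β m)) (G (subE β m))) (act-+ p F G β))
        (+-interchange (a * F (subE β m)) (a * G (subE β m)) (act p F β) (act p G β))

act-* : ∀ {N} (p : LPoly N) c F β → act p (λ γ → c * F γ) β ≡ c * act p F β
act-* [] c F β = sym (ℚP.*-zeroʳ c)
act-* ((a , m) ∷ p) c F β =
  trans (+-congˡ (a * (c * F (subE β m))) (act-* p c F β)) (pull a c (F (subE β m)) (act p F β))
  where
  pull : ∀ a c f r → a * (c * f) + c * r ≡ c * (a * f + r)
  pull = ℚ-solve 4 (λ a c f r → a :* (c :* f) :+ c :* r := c :* (a :* f :+ r)) refl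

act-neg : ∀ {N} (p : LPoly N) F β → act p (λ γ → - F γ) β ≡ - act p F β
act-neg [] F β = refl
act-neg ((a , m) ∷ p) F β = trans (+-congˡ (a * - F (subE β m)) (act-neg p F β)) (pull a (F (subE β m)) (act p F β))
  where
  pull : ∀ a f r → a * (- f) + (- r) ≡ - (a * f + r)
  pull = ℚ-solve 3 (λ a f r → a :* (:- f) :+ (:- r) := :- (a :* f :+ r)) refl

act-sub : ∀ {N} (p : LPoly N) F G β → act p (λ γ → F γ - G γ) β ≡ act p F β - act p G β
act-sub p F G β = trans (act-+ p F (λ γ → - G γ) β) (+-congˡ (act p F β) (act-neg p G β))

act-negˡ : ∀ {N} (p : LPoly N) F β → act (neg p) F β ≡ - act p F β
act-negˡ [] F β = refl
act-negˡ ((a , m) ∷ p) F β =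
  trans (+-congˡ (- a * F (subE β m)) (act-negˡ p F β)) (pull a (F (subE β m)) (act p F β))
  where
  pull : ∀ a f r → (- a) * f + (- r) ≡ - (a * f + r)
  pull = ℚ-solve 3 (λ a f r → (:- a) :* f :+ (:- r) := :- (a :* f :+ r)) refl

act-subE : ∀ {N} (q : LPoly N) F (m : Exp N) β →
  act q (λ γ → F (subE γ m)) β ≡ act q F (subE β m)
act-subE [] F m β = refl
act-subE ((b , m') ∷ q) F m β =
  cong₂ _+_ (cong (λ v → b * F v) (subE-subE-comm β m' m)) (act-subE q F m β)

act-⊗ : ∀ {N} (p q : LPoly N) F β → act (p ⊗ q) F β ≡ act p (act q F) β
act-⊗ [] q F β = refl
act-⊗ ((a , m) ∷ p) q F β =
  trans (act-⊕ (shifted q) _ F β) (cong₂ _+_ (act-shifted q) (act-⊗ p q F β))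
  where
  shifted : LPoly _ → LPoly _
  shifted = L.map (λ { (q' , m') → (a * q' , addE m m') })
  act-shifted : ∀ r → act (shifted r) F β ≡ a * act r F (subE β m)
  act-shifted [] = sym (ℚP.*-zeroʳ a)
  act-shifted ((b , m') ∷ r) =
    trans (cong₂ _+_ (cong (λ v → a * b * F v) (subE-addE β m m')) (act-shifted r))
          (pull a b (F (subE (subE β m) m')) (act r F (subE β m)))
    where
    pull : ∀ a b f r → a * b * f + a * r ≡ a * (b * f + r)
    pull = ℚ-solve 4 (λ a b f r → a :* b :* f :+ a :* r := a :* (b :* f :+ r)) refl

act-comm : ∀ {N} (p q : LPoly N) F β → act p (act q F) β ≡ act q (act p F) β
act-comm [] q F β = sym (act-zeroʳ q β)
act-comm ((a , m) ∷ p) q F β = begin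
  a * act q F (subE β m) + act p (act q F) β
    ≡⟨ cong₂ _+_ (cong (a *_) (sym (act-subE q F m β))) (act-comm p q F β) ⟩
  a * act q (λ γ → F (subE γ m)) β + act q (act p F) β
    ≡⟨ cong (_+ act q (act p F) β) (sym (act-* q a (λ γ → F (subE γ m)) β)) ⟩
  act q (λ γ → a * F (subE γ m)) β + act q (act p F) β
    ≡⟨ sym (act-+ q (λ γ → a * F (subE γ m)) (act p F) β) ⟩
  act q (act ((a , m) ∷ p) F) β ∎
  where open ≡-Reasoning

act-one : ∀ {N} F (β : Exp N) → act one F β ≡ F β
act-one F β = trans (ℚP.+-identityʳ _) (trans (ℚP.*-identityˡ _) (cong F (subE-identityʳ β)))

act-mono : ∀ {N} (m : Exp N) F β → act (mono 1ℚ m) F β ≡ F (subE β m)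
act-mono m F β = trans (ℚP.+-identityʳ _) (ℚP.*-identityˡ _)

OneMinus : ∀ {N} → Exp N → LPoly N
OneMinus M = one ⊕ neg (mono 1ℚ M)

act-OneMinus : ∀ {N} (M : Exp N) F β → act (OneMinus M) F β ≡ F β - F (subE β M)
act-OneMinus M F β =
  trans (act-⊕ one (neg (mono 1ℚ M)) F β)
        (cong₂ _+_ (act-one F β) (trans (act-negˡ (mono 1ℚ M) F β) (cong -_ (act-mono M F β))))

act-coeff : ∀ {N} (q X : LPoly N) β → act q (coeff X) β ≡ coeff (q ⊗ X) β
act-coeff q X β = trans (act-cong q (λ γ → sym (act-δ X γ)) β) (trans (sym (act-⊗ q X δ β)) (act-δ (q ⊗ X) β))

sumℚ-+ : ∀ n (f g : Fin n → ℚ) → sumℚ n (λ i → f i + g i) ≡ sumℚ n f + sumℚ n g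
sumℚ-+ zero f g = refl
sumℚ-+ (suc n) f g =
  trans (+-congˡ (f F.zero + g F.zero) (sumℚ-+ n (λ i → f (F.suc i)) (λ i → g (F.suc i))))
        (+-interchange (f F.zero) (g F.zero) (sumℚ n (λ i → f (F.suc i))) (sumℚ n (λ i → g (F.suc i))))

sumℚ-cong : ∀ n {f g : Fin n → ℚ} → (∀ i → f i ≡ g i) → sumℚ n f ≡ sumℚ n g
sumℚ-cong zero f≗g = refl
sumℚ-cong (suc n) f≗g = cong₂ _+_ (f≗g F.zero) (sumℚ-cong n (λ i → f≗g (F.suc i)))

act-sumℚ : ∀ {N} (q : LPoly N) n (G : Fin n → Ser N) β →
  act q (λ γ → sumℚ n (λ i → G i γ)) β ≡ sumℚ n (λ i → act q (G i) β)
act-sumℚ q zero G β = act-zeroʳ q β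
act-sumℚ q (suc n) G β =
  trans (act-+ q (G F.zero) (λ γ → sumℚ n (λ i → G (F.suc i) γ)) β)
        (+-congˡ (act q (G F.zero) β) (act-sumℚ q n (λ i → G (F.suc i)) β))

act-sumP : ∀ {N} n (Bs : Fin n → LPoly N) F β →
  act (sumP n Bs) F β ≡ sumℚ n (λ i → act (Bs i) F β)
act-sumP zero Bs F β = refl
act-sumP (suc n) Bs F β =
  trans (act-⊕ (Bs F.zero) _ F β) (+-congˡ (act (Bs F.zero) F β) (act-sumP n (λ i → Bs (F.suc i)) F β))

remove : ∀ {N} → Exp N → LPoly N → LPoly N
remove m0 [] = []
remove m0 ((a , m) ∷ q) = if ⌊ ≡-dec ℤ._≟_ m m0 ⌋ then remove m0 q else (a , m) ∷ remove m0 q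

act-remove : ∀ {N} (q : LPoly N) F β m0 →
  act q F β ≡ coeff q m0 * F (subE β m0) + act (remove m0 q) F β
act-remove [] F β m0 = sym (trans (cong (_+ 0ℚ) (ℚP.*-zeroˡ (F (subE β m0)))) (ℚP.+-identityʳ 0ℚ))
act-remove ((a , m) ∷ q) F β m0 with ≡-dec ℤ._≟_ m m0
... | yes refl = trans (+-congˡ (a * F (subE β m)) (act-remove q F β m))
                       (collect a (coeff q m) (F (subE β m)) (act (remove m q) F β))
  where
  collect : ∀ a c f r → a * f + (c * f + r) ≡ (a + c) * f + r
  collect = ℚ-solve 4 (λ a c f r → a :* f :+ (c :* f :+ r) := (a :+ c) :* f :+ r) refl
... | no _ = trans (+-congˡ (a * F (subE β m)) (act-remove q F β m0))
                   (reorder (a * F (subE β m)) (coeff q m0) (F (subE β m0)) (act (remove m0 q) F β))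
  where
  reorder : ∀ x c f r → x + (c * f + r) ≡ (0ℚ + c) * f + (x + r)
  reorder = ℚ-solve 4 (λ x c f r → x :+ (c :* f :+ r) := (con 0ℚ :+ c) :* f :+ (x :+ r)) refl

coeff-remove-same : ∀ {N} (q : LPoly N) m0 → coeff (remove m0 q) m0 ≡ 0ℚ
coeff-remove-same [] m0 = refl
coeff-remove-same ((a , m) ∷ q) m0 with ≡-dec ℤ._≟_ m m0
... | yes _ = coeff-remove-same q m0
... | no m≢m0 = trans (cong (_+ coeff (remove m0 q) m0) (if-no (≡-dec ℤ._≟_ m m0) m≢m0))
                      (trans (ℚP.+-identityˡ _) (coeff-remove-same q m0))

coeff-remove-other : ∀ {N} (q : LPoly N) m0 m → m ≢ m0 → coeff (remove m0 q) m ≡ coeff q m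
coeff-remove-other [] m0 m m≢m0 = refl
coeff-remove-other ((a , m') ∷ q) m0 m m≢m0 with ≡-dec ℤ._≟_ m' m0
... | yes refl = trans (coeff-remove-other q m' m m≢m0)
                   (sym (trans (cong (_+ coeff q m) (if-no (≡-dec ℤ._≟_ m' m) (λ e → m≢m0 (sym e))))
                               (ℚP.+-identityˡ _)))
... | no _ = +-congˡ (if ⌊ ≡-dec ℤ._≟_ m' m ⌋ then a else 0ℚ) (coeff-remove-other q m0 m m≢m0)

length-remove-head : ∀ {N} a (m0 : Exp N) q → L.length (remove m0 ((a , m0) ∷ q)) ℕ.≤ L.length q
length-remove-head a m0 q =
  subst (λ r → L.length r ℕ.≤ L.length q) (sym (if-yes (≡-dec ℤ._≟_ m0 m0) refl)) (≤-length q)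
  where
  ≤-length : ∀ q → L.length (remove m0 q) ℕ.≤ L.length q
  ≤-length [] = ℕ.z≤n
  ≤-length ((a , m) ∷ q) with ≡-dec ℤ._≟_ m m0
  ... | yes _ = ℕP.m≤n⇒m≤1+n (≤-length q)
  ... | no _ = ℕ.s≤s (≤-length q)

*-congˡ-≢0 : ∀ c {x y} → (c ≢ 0ℚ → x ≡ y) → c * x ≡ c * y
*-congˡ-≢0 c {x} {y} agree with c ℚP.≟ 0ℚ
... | yes refl = trans (ℚP.*-zeroˡ x) (sym (ℚP.*-zeroˡ y))
... | no c≢0 = cong (c *_) (agree c≢0)

-- Terms of q with equal exponents may cancel, so they are collected first with remove.
act-local : ∀ {N} (q : LPoly N) F G β →
  (∀ m → coeff q m ≢ 0ℚ → F (subE β m) ≡ G (subE β m)) → act q F β ≡ act q G β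
act-local q F G β = go (L.length q) q ℕP.≤-refl
  where
  go : ∀ n q → L.length q ℕ.≤ n →
    (∀ m → coeff q m ≢ 0ℚ → F (subE β m) ≡ G (subE β m)) → act q F β ≡ act q G β
  go _ [] _ _ = refl
  go (suc n) q@((a , m0) ∷ q') (ℕ.s≤s len) agree = begin
    act q F β                                            ≡⟨ act-remove q F β m0 ⟩
    coeff q m0 * F (subE β m0) + act (remove m0 q) F β   ≡⟨ cong₂ _+_ head-agrees rest-agrees ⟩
    coeff q m0 * G (subE β m0) + act (remove m0 q) G β   ≡⟨ act-remove q G β m0 ⟨
    act q G β                                            ∎
    where
    open ≡-Reasoning
    head-agrees : coeff q m0 * F (subE β m0) ≡ coeff q m0 * G (subE β m0)
    head-agrees = *-congˡ-≢0 (coeff q m0) (agree m0)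
    rest-agrees : act (remove m0 q) F β ≡ act (remove m0 q) G β
    rest-agrees = go n (remove m0 q) (ℕP.≤-trans (length-remove-head a m0 q') len) λ m c≢0 →
      agree m (λ c≡0 → c≢0 (trans (coeff-remove-other q m0 m (λ { refl → c≢0 (coeff-remove-same q m0) })) c≡0))

act-local-0 : ∀ {N} (q : LPoly N) F β →
  (∀ m → coeff q m ≢ 0ℚ → F (subE β m) ≡ 0ℚ) → act q F β ≡ 0ℚ
act-local-0 q F β vanish = trans (act-local q F (λ _ → 0ℚ) β vanish) (act-zeroʳ q β)

coeff≢0⇒∈ : ∀ {N} (q : LPoly N) β → coeff q β ≢ 0ℚ → β ∈ L.map proj₂ q
coeff≢0⇒∈ [] β c≢0 = contradiction refl c≢0
coeff≢0⇒∈ ((a , m) ∷ q) β c≢0 with ≡-dec ℤ._≟_ m β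
... | yes m≡β = here (sym m≡β)
... | no _ = there (coeff≢0⇒∈ q β (λ e → c≢0 (trans (ℚP.+-identityˡ _) e)))

InK-⊆ : ∀ {N} {F G : Ser N} → InK F → (∀ β → G β ≢ 0ℚ → F β ≢ 0ℚ) → InK G
InK-⊆ {zero} _ _ = tt
InK-⊆ {suc N} ((b , b≤) , slices) G⊆F =
  (b , λ e vs G≢0 → b≤ e vs (G⊆F (e ∷ vs) G≢0)) , λ e → InK-⊆ (slices e) (λ vs → G⊆F (e ∷ vs))

minHead : ∀ {N} → List (Exp (suc N)) → ℤ
minHead [] = + 0
minHead ((e ∷ v) ∷ L) = e ℤ.⊓ minHead L

minHead-≤ : ∀ {N} (L : List (Exp (suc N))) e vs → (e ∷ vs) ∈ L → minHead L ℤ.≤ e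
minHead-≤ ((e ∷ v) ∷ L) e' vs (here refl) = ℤP.i⊓j≤i e (minHead L)
minHead-≤ ((e ∷ v) ∷ L) e' vs (there mem) = ℤP.≤-trans (ℤP.i⊓j≤j e (minHead L)) (minHead-≤ L e' vs mem)

InK-finite : ∀ {N} (L : List (Exp N)) {F : Ser N} → (∀ β → F β ≢ 0ℚ → β ∈ L) → InK F
InK-finite {zero} L _ = tt
InK-finite {suc N} L supp⊆L =
  (minHead L , λ e vs F≢0 → minHead-≤ L e vs (supp⊆L (e ∷ vs) F≢0)) ,
  λ e → InK-finite (L.map V.tail L) (λ vs F≢0 → ∈-map⁺ V.tail (supp⊆L (e ∷ vs) F≢0))

InK-0 : ∀ {N} → InK {N} (λ _ → 0ℚ)
InK-0 = InK-finite [] (λ β 0≢0 → contradiction refl 0≢0)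

InK-δ : ∀ {N} → InK {N} δ
InK-δ = InK-finite (0E ∷ []) (λ β δβ≢0 → here (δ≢0⇒≡0E β δβ≢0))

InK-coeff : ∀ {N} (p : LPoly N) → InK (coeff p)
InK-coeff p = InK-finite (L.map proj₂ p) (coeff≢0⇒∈ p)

InK-+ : ∀ {N} {F G : Ser N} → InK F → InK G → InK (λ β → F β + G β)
InK-+ {zero} _ _ = tt
InK-+ {suc N} {F} {G} ((b , b≤) , slicesF) ((b' , b'≤) , slicesG) =
  (b ℤ.⊓ b' , bound) , λ e → InK-+ (slicesF e) (slicesG e)
  where
  bound : ∀ e vs → F (e ∷ vs) + G (e ∷ vs) ≢ 0ℚ → b ℤ.⊓ b' ℤ.≤ e
  bound e vs F+G≢0 with x+y≢0⇒x≢0⊎y≢0 _ _ F+G≢0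
  ... | inj₁ F≢0 = ℤP.≤-trans (ℤP.i⊓j≤i b b') (b≤ e vs F≢0)
  ... | inj₂ G≢0 = ℤP.≤-trans (ℤP.i⊓j≤j b b') (b'≤ e vs G≢0)

InK-shift : ∀ {N} {F : Ser N} → InK F → ∀ a (m : Exp N) → InK (λ β → a * F (subE β m))
InK-shift {zero} _ a m = tt
InK-shift {suc N} {F} ((b , b≤) , slices) a (m0 ∷ m) =
  (b ℤ.+ m0 , λ e vs ≢0 → shifted-bound e (b≤ (e ℤ.- m0) (subE vs m) (x*y≢0⇒y≢0 a _ ≢0))) ,
  λ e → InK-shift (slices (e ℤ.- m0)) a m
  where
  shifted-bound : ∀ e → b ℤ.≤ e ℤ.- m0 → b ℤ.+ m0 ℤ.≤ e
  shifted-bound e b≤e-m0 =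
    subst (b ℤ.+ m0 ℤ.≤_) (i-j+j≡i e m0) (ℤP.+-monoˡ-≤ m0 b≤e-m0)

InK-act : ∀ {N} (p : LPoly N) {F : Ser N} → InK F → InK (act p F)
InK-act [] F∈K = InK-0
InK-act ((a , m) ∷ p) F∈K = InK-+ (InK-shift F∈K a m) (InK-act p F∈K)

InK-sub : ∀ {N} {F G : Ser N} → InK F → InK G → InK (λ β → F β - G β)
InK-sub F∈K G∈K = InK-+ F∈K (InK-⊆ G∈K (λ β → -x≢0⇒x≢0 _))

InK-sumℚ : ∀ {N} n (G : Fin n → Ser N) → (∀ i → InK (G i)) → InK (λ β → sumℚ n (λ i → G i β))
InK-sumℚ zero G _ = InK-0
InK-sumℚ (suc n) G G∈K = InK-+ (G∈K F.zero) (InK-sumℚ n (λ i → G (F.suc i)) (λ i → G∈K (F.suc i)))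

-- No zero divisors

offset-view : ∀ b e → e ℤ.< b ⊎ ∃ λ k → e ≡ b ℤ.+ + k
offset-view b e with b ℤP.≤? e
... | no b≰e = inj₁ (ℤP.≰⇒> b≰e)
... | yes b≤e = inj₂ (ℤ.∣ e ℤ.- b ∣ , sym (begin
  b ℤ.+ + ℤ.∣ e ℤ.- b ∣  ≡⟨ cong (λ z → b ℤ.+ z) (ℤP.0≤i⇒+∣i∣≡i (ℤP.i≤j⇒0≤j-i b≤e)) ⟩
  b ℤ.+ (e ℤ.- b)        ≡⟨ solve (b L.∷ e L.∷ L.[]) ⟩
  e                      ∎))
  where open ≡-Reasoning

≤⇒offset : ∀ {b e} → b ℤ.≤ e → ∃ λ k → e ≡ b ℤ.+ + k
≤⇒offset {b} {e} b≤e with offset-view b e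
... | inj₁ e<b = contradiction b≤e (ℤP.<⇒≱ e<b)
... | inj₂ offset = offset

i<i+suc : ∀ i t → i ℤ.< i ℤ.+ + suc t
i<i+suc i t = subst (ℤ._< i ℤ.+ + suc t) (ℤP.+-identityʳ i) (ℤP.+-monoʳ-< i (ℤ.+<+ (ℕ.s≤s ℕ.z≤n)))

+-cancelˡ-<-pos : ∀ b k n → b ℤ.+ + k ℤ.< b ℤ.+ + n → k ℕ.< n
+-cancelˡ-<-pos b k n lt with n ℕP.≤? k
... | no n≰k = ℕP.≰⇒> n≰k
... | yes n≤k = contradiction (ℤP.+-monoʳ-≤ b (ℤ.+≤+ n≤k)) (ℤP.<⇒≱ lt)

slice : ∀ {N} → ℤ → LPoly (suc N) → LPoly N
slice e [] = []
slice e ((a , e' ∷ m) ∷ q) = if ⌊ e' ℤ.≟ e ⌋ then (a , m) ∷ slice e q else slice e q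

coeff-slice : ∀ {N} e (q : LPoly (suc N)) m → coeff (slice e q) m ≡ coeff q (e ∷ m)
coeff-slice e [] m = refl
coeff-slice e ((a , e' ∷ m') ∷ q) m with e' ℤ.≟ e
... | no _ = trans (coeff-slice e q m) (sym (ℚP.+-identityˡ _))
... | yes refl with ≡-dec ℤ._≟_ m' m
...   | yes refl = +-congˡ a (coeff-slice e' q m')
...   | no _ = +-congˡ 0ℚ (coeff-slice e' q m)

onSlice : ∀ {N} → ℤ → Ser N → Ser (suc N)
onSlice d G (e ∷ w) = if ⌊ e ℤ.≟ d ⌋ then G w else 0ℚ

act-onSlice : ∀ {N} (r : LPoly (suc N)) d e0 (G : Ser N) vs →
  act r (onSlice d G) ((d ℤ.+ e0) ∷ vs) ≡ act (slice e0 r) G vs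
act-onSlice [] d e0 G vs = refl
act-onSlice ((a , e1 ∷ m) ∷ r) d e0 G vs with e1 ℤ.≟ e0
... | yes refl = cong₂ _+_ (cong (a *_) (if-yes (d ℤ.+ e1 ℤ.- e1 ℤ.≟ d) (i+j-j≡i d e1)))
                           (act-onSlice r d e1 G vs)
... | no e1≢e0 = trans (cong₂ _+_ (cong (a *_) (if-no (d ℤ.+ e0 ℤ.- e1 ℤ.≟ d) off-slice))
                                  (act-onSlice r d e0 G vs))
                       (trans (cong (_+ _) (ℚP.*-zeroʳ a)) (ℚP.+-identityˡ _))
  where
  off-slice : d ℤ.+ e0 ℤ.- e1 ≢ d
  off-slice eq = e1≢e0 (sym (begin
    e0                          ≡⟨ solve (d L.∷ e0 L.∷ e1 L.∷ L.[]) ⟩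
    d ℤ.+ e0 ℤ.- e1 ℤ.- d ℤ.+ e1 ≡⟨ cong (λ z → z ℤ.- d ℤ.+ e1) eq ⟩
    d ℤ.- d ℤ.+ e1              ≡⟨ solve (d L.∷ e1 L.∷ L.[]) ⟩
    e1                          ∎))
    where open ≡-Reasoning

act-lowest-slice : ∀ {N} (q : LPoly (suc N)) (F : Ser (suc N)) e0 d →
  (∀ e1 m → coeff q (e1 ∷ m) ≢ 0ℚ → e0 ℤ.≤ e1) →
  (∀ e vs → e ℤ.< d → F (e ∷ vs) ≡ 0ℚ) →
  ∀ vs → act q F ((d ℤ.+ e0) ∷ vs) ≡ act (slice e0 q) (λ w → F (d ∷ w)) vs
act-lowest-slice q F e0 d q≥e0 F≥d vs =
  trans (act-local q F (onSlice d (λ w → F (d ∷ w))) ((d ℤ.+ e0) ∷ vs) agree)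
        (act-onSlice q d e0 (λ w → F (d ∷ w)) vs)
  where
  agree : ∀ m → coeff q m ≢ 0ℚ →
    F (subE ((d ℤ.+ e0) ∷ vs) m) ≡ onSlice d (λ w → F (d ∷ w)) (subE ((d ℤ.+ e0) ∷ vs) m)
  agree (e1 ∷ m) q≢0 with ≤⇒offset (q≥e0 e1 m q≢0)
  ... | zero , refl = trans (cong (λ z → F (z ∷ subE vs m)) on-slice)
                            (sym (if-yes (d ℤ.+ e0 ℤ.- (e0 ℤ.+ + 0) ℤ.≟ d) on-slice))
    where
    on-slice : d ℤ.+ e0 ℤ.- (e0 ℤ.+ + 0) ≡ d
    on-slice = trans (cong (λ z → d ℤ.+ e0 ℤ.- z) (ℤP.+-identityʳ e0)) (i+j-j≡i d e0)
  ... | suc t , refl = trans (F≥d _ (subE vs m) below)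
                             (sym (if-no (d ℤ.+ e0 ℤ.- (e0 ℤ.+ + suc t) ℤ.≟ d) (ℤP.<⇒≢ below)))
    where
    below : d ℤ.+ e0 ℤ.- (e0 ℤ.+ + suc t) ℤ.< d
    below = subst₂ ℤ._<_ (regroup d e0 (+ suc t)) (i-j+j≡i d (+ suc t)) (i<i+suc (d ℤ.- + suc t) t)
      where
      regroup : ∀ d e0 s → d ℤ.- s ≡ d ℤ.+ e0 ℤ.- (e0 ℤ.+ s)
      regroup = solve-∀

Nonzero? : ∀ {N} (p : LPoly N) → Dec (Nonzero p)
Nonzero? p with any? (λ m → ¬? (coeff p m ℚP.≟ 0ℚ)) (L.map proj₂ p)
... | yes found = yes (Any.satisfied found)
... | no none = no (λ { (m , c≢0) → none (lose (coeff≢0⇒∈ p m c≢0) c≢0) })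

least-from : (P : ℤ → Set) → (∀ e → Dec (P e)) → ∀ n b → (∀ e → P e → b ℤ.≤ e) →
  P (b ℤ.+ + n) → Σ ℤ λ e0 → P e0 × (∀ e → P e → e0 ℤ.≤ e)
least-from P P? zero b b≤ Pb = b ℤ.+ + 0 , Pb , λ e Pe → subst (ℤ._≤ e) (sym (ℤP.+-identityʳ b)) (b≤ e Pe)
least-from P P? (suc n) b b≤ Pb+n with P? b
... | yes Pb = b , Pb , b≤
... | no ¬Pb = least-from P P? n (ℤ.suc b) suc-b≤ (subst P (shift b (+ n)) Pb+n)
  where
  shift : ∀ b n → b ℤ.+ (+ 1 ℤ.+ n) ≡ + 1 ℤ.+ b ℤ.+ n
  shift = solve-∀
  suc-b≤ : ∀ e → P e → ℤ.suc b ℤ.≤ e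
  suc-b≤ e Pe = ℤP.i<j⇒suc[i]≤j (ℤP.≤∧≢⇒< (b≤ e Pe) (λ { refl → ¬Pb Pe }))

coeff≢0⇒minHead≤ : ∀ {N} (q : LPoly (suc N)) e m → coeff q (e ∷ m) ≢ 0ℚ → minHead (L.map proj₂ q) ℤ.≤ e
coeff≢0⇒minHead≤ q e m q≢0 = minHead-≤ (L.map proj₂ q) e m (coeff≢0⇒∈ q (e ∷ m) q≢0)

lowest-slice : ∀ {N} (q : LPoly (suc N)) → Nonzero q →
  Σ ℤ λ e0 → Nonzero (slice e0 q) × (∀ e1 m → coeff q (e1 ∷ m) ≢ 0ℚ → e0 ℤ.≤ e1)
lowest-slice q ((e ∷ m) , q≢0) with ≤⇒offset (coeff≢0⇒minHead≤ q e m q≢0)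
... | n , e≡ with least-from (λ e → Nonzero (slice e q)) (λ e → Nonzero? (slice e q)) n (minHead (L.map proj₂ q))
                   (λ e (m , s≢0) → coeff≢0⇒minHead≤ q e m (λ z → s≢0 (trans (coeff-slice e q m) z)))
                   (subst (λ z → Nonzero (slice z q)) e≡ (m , λ z → q≢0 (trans (sym (coeff-slice e q m)) z)))
... | e0 , s≢0 , least = e0 , s≢0 , λ e1 m q≢0 → least e1 (m , λ z → q≢0 (trans (sym (coeff-slice e1 q m)) z))

act-[] : ∀ (q : LPoly zero) F → act q F [] ≡ coeff q [] * F []
act-[] q F = trans (act-remove q F [] [])
  (trans (+-congˡ (coeff q [] * F []) (act-local-0 (remove [] q) F [] rest≡0)) (ℚP.+-identityʳ _))
  where
  rest≡0 : ∀ m → coeff (remove [] q) m ≢ 0ℚ → F (subE [] m) ≡ 0ℚ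
  rest≡0 [] r≢0 = contradiction (coeff-remove-same q []) r≢0

act≡0⇒≡0 : ∀ {N} (q : LPoly N) → Nonzero q → ∀ (F : Ser N) → InK F →
  (∀ β → act q F β ≡ 0ℚ) → ∀ β → F β ≡ 0ℚ
act≡0⇒≡0 {zero} q ([] , q≢0) F _ qF≡0 [] =
  x*y≡0⇒y≡0 (coeff q []) (F []) q≢0 (trans (sym (act-[] q F)) (qF≡0 []))
act≡0⇒≡0 {suc N} q q≢0 F ((b , b≤) , F-slices∈K) qF≡0 (E ∷ vs) with lowest-slice q q≢0
... | e0 , slice≢0 , q≥e0 = everywhere E vs
  where
  below-b : ∀ e vs → e ℤ.< b → F (e ∷ vs) ≡ 0ℚ
  below-b e vs e<b = ≡0-stable _ (λ F≢0 → ℤP.<⇒≱ e<b (b≤ e vs F≢0))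
  below : ∀ k → (∀ {k'} → k' ℕ.< k → ∀ vs → F ((b ℤ.+ + k') ∷ vs) ≡ 0ℚ) →
    ∀ e vs → e ℤ.< b ℤ.+ + k → F (e ∷ vs) ≡ 0ℚ
  below k lower e vs e<b+k with offset-view b e
  ... | inj₁ e<b = below-b e vs e<b
  ... | inj₂ (k' , refl) = lower (+-cancelˡ-<-pos b k' k e<b+k) vs
  -- With the lower slices of F gone, the slice b + k + e0 of q F is the lowest slice of q
  -- acting on the slice b + k of F.
  slice-vanishes : ∀ k → ∀ vs → F ((b ℤ.+ + k) ∷ vs) ≡ 0ℚ
  slice-vanishes = <-rec _ λ k lower →
    act≡0⇒≡0 (slice e0 q) slice≢0 (λ w → F ((b ℤ.+ + k) ∷ w)) (F-slices∈K _)
      (λ w → trans (sym (act-lowest-slice q F e0 (b ℤ.+ + k) q≥e0 (below k lower) w)) (qF≡0 _))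
  everywhere : ∀ E vs → F (E ∷ vs) ≡ 0ℚ
  everywhere E vs with offset-view b E
  ... | inj₁ E<b = below-b E vs E<b
  ... | inj₂ (k , refl) = slice-vanishes k vs

isLarge⇒isSmall-negE : ∀ {N} (M : Exp N) → isLarge M ≡ true → isSmall (negE M) ≡ true
isLarge⇒isSmall-negE (+ zero ∷ M) large = isLarge⇒isSmall-negE M large
isLarge⇒isSmall-negE (-[1+ x ] ∷ M) _ = refl

¬isSmall⇒isLarge : ∀ {N} (M : Exp N) j → lookup M j ≢ + 0 → isSmall M ≡ false → isLarge M ≡ true
¬isSmall⇒isLarge (+ zero ∷ M) F.zero Mj≢0 _ = contradiction refl Mj≢0
¬isSmall⇒isLarge (+ zero ∷ M) (F.suc j) Mj≢0 ¬small = ¬isSmall⇒isLarge M j Mj≢0 ¬small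
¬isSmall⇒isLarge (-[1+ x ] ∷ M) j _ _ = refl

isSmall⇒¬isLarge : ∀ {N} (M : Exp N) → isSmall M ≡ true → isLarge M ≡ false
isSmall⇒¬isLarge (+ zero ∷ M) small = isSmall⇒¬isLarge M small
isSmall⇒¬isLarge (+[1+ x ] ∷ M) _ = refl

χ-isSmall+χ-isLarge : ∀ {N} (M : Exp N) j → lookup M j ≢ + 0 → χ (isSmall M) + χ (isLarge M) ≡ 1ℚ
χ-isSmall+χ-isLarge M j Mj≢0 with isSmall M in small
... | true rewrite isSmall⇒¬isLarge M small = refl
... | false rewrite ¬isSmall⇒isLarge M j Mj≢0 small = refl

InK-ray : ∀ {N} (M v : Exp N) → isSmall M ≡ true → {F : Ser N} →
  (∀ β → F β ≢ 0ℚ → ∃ λ k → β ≡ addE v (scaleE k M)) → InK F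
InK-ray {zero} M v _ _ = tt
InK-ray {suc N} (+ zero ∷ M) (w ∷ v) small {F} on-ray =
  (w , bound) , λ e → InK-ray M v small (λ vs F≢0 → let k , eq = on-ray (e ∷ vs) F≢0 in k , cong V.tail eq)
  where
  bound : ∀ e vs → F (e ∷ vs) ≢ 0ℚ → w ℤ.≤ e
  bound e vs F≢0 with on-ray (e ∷ vs) F≢0
  ... | k , eq = ℤP.≤-reflexive (sym (trans (cong V.head eq)
                   (trans (cong (λ z → w ℤ.+ z) (ℤP.*-zeroʳ (+ k))) (ℤP.+-identityʳ w))))
InK-ray {suc N} (+[1+ a ] ∷ M) (w ∷ v) _ {F} on-ray =
  (w , bound) , λ e → InK-finite (L.map (λ k → addE v (scaleE k M)) (L.upTo (suc ℤ.∣ e ℤ.- w ∣))) (finite e)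
  where
  on-ray′ : ∀ e vs → F (e ∷ vs) ≢ 0ℚ →
    Σ ℕ λ k → (e ≡ w ℤ.+ + (k ℕ.* suc a)) × (vs ≡ addE v (scaleE k M))
  on-ray′ e vs F≢0 with on-ray (e ∷ vs) F≢0
  ... | k , eq = k , trans (cong V.head eq) (cong (λ z → w ℤ.+ z) (sym (ℤP.pos-* k (suc a)))) , cong V.tail eq
  bound : ∀ e vs → F (e ∷ vs) ≢ 0ℚ → w ℤ.≤ e
  bound e vs F≢0 with on-ray′ e vs F≢0
  ... | k , refl , _ = ℤP.i≤i+j w (+ (k ℕ.* suc a))
  finite : ∀ e vs → F (e ∷ vs) ≢ 0ℚ → vs ∈ L.map (λ k → addE v (scaleE k M)) (L.upTo (suc ℤ.∣ e ℤ.- w ∣))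
  finite e vs F≢0 with on-ray′ e vs F≢0
  ... | k , refl , refl = ∈-map⁺ (λ k → addE v (scaleE k M)) (∈-upTo⁺ (ℕ.s≤s k≤))
    where
    k≤ : k ℕ.≤ ℤ.∣ w ℤ.+ + (k ℕ.* suc a) ℤ.- w ∣
    k≤ = subst (k ℕ.≤_) (sym (cong ℤ.∣_∣ (i+j-i≡j w (+ (k ℕ.* suc a))))) (ℕP.m≤m*n k (suc a))

-- The expansion of 1/(1 - M) in K

module Geometric {N} (j : Fin N) (A : ℕ) .{{_ : ℕ.NonZero A}} (M : Exp N) (M-j : lookup M j ≡ + A) where

  onMultiples : Exp N → ℤ → ℚ
  onMultiples β (+ n) = if ⌊ ≡-dec ℤ._≟_ β (scaleE (n ℕ./ A) M) ⌋ then 1ℚ else 0ℚ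
  onMultiples β -[1+ _ ] = 0ℚ

  -- geomSmall = Σ_{k ≥ 0} M^k; the only candidate k is read off the x_j-degree, which is k A.
  geomSmall : Ser N
  geomSmall β = onMultiples β (lookup β j)

  -- geomLarge = - Σ_{k ≥ 0} M^{-k-1}
  geomLarge : Ser N
  geomLarge β = - geomSmall (subE (negE β) M)

  lookup-scaleE-M : ∀ k → lookup (scaleE k M) j ≡ + (k ℕ.* A)
  lookup-scaleE-M k = trans (lookup-scaleE k M j) (trans (cong (+ k ℤ.*_) M-j) (sym (ℤP.pos-* k A)))

  geomSmall-scaleE : ∀ k → geomSmall (scaleE k M) ≡ 1ℚ
  geomSmall-scaleE k rewrite lookup-scaleE-M k =
    if-yes (≡-dec ℤ._≟_ _ (scaleE (k ℕ.* A ℕ./ A) M)) (cong (λ z → scaleE z M) (sym (m*n/n≡m k A)))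

  MultipleOrNot : Exp N → Set
  MultipleOrNot β = (geomSmall β ≡ 1ℚ × ∃ λ k → β ≡ scaleE k M) ⊎ (geomSmall β ≡ 0ℚ × ∀ k → β ≢ scaleE k M)

  geomSmall-view : ∀ β → MultipleOrNot β
  geomSmall-view β = view (lookup β j) refl
    where
    not-multiple : geomSmall β ≡ 0ℚ → ∀ k → β ≢ scaleE k M
    not-multiple g≡0 k refl = ℚP.1≢0 (trans (sym (geomSmall-scaleE k)) g≡0)
    view : ∀ t → lookup β j ≡ t → MultipleOrNot β
    view -[1+ _ ] β-j = inj₂ (g≡0 , not-multiple g≡0)
      where
      g≡0 : geomSmall β ≡ 0ℚ
      g≡0 = cong (onMultiples β) β-j
    view (+ n) β-j with ≡-dec ℤ._≟_ β (scaleE (n ℕ./ A) M)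
    ... | yes β≡ = inj₁ (trans (cong (onMultiples β) β-j) (if-yes (≡-dec ℤ._≟_ β _) β≡) , n ℕ./ A , β≡)
    ... | no β≢ = inj₂ (g≡0 , not-multiple g≡0)
      where
      g≡0 : geomSmall β ≡ 0ℚ
      g≡0 = trans (cong (onMultiples β) β-j) (if-no (≡-dec ℤ._≟_ β _) β≢)

  geomSmall-negative : ∀ γ → lookup γ j ℤ.< + 0 → geomSmall γ ≡ 0ℚ
  geomSmall-negative γ γ-j<0 with geomSmall-view γ
  ... | inj₂ (g≡0 , _) = g≡0
  ... | inj₁ (_ , k , refl) =
    contradiction (subst (+ 0 ℤ.≤_) (sym (lookup-scaleE-M k)) (ℤ.+≤+ ℕ.z≤n)) (ℤP.<⇒≱ γ-j<0)

  δ-not-multiple : ∀ {β} → (∀ k → β ≢ scaleE k M) → δ β ≡ 0ℚ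
  δ-not-multiple not-multiple = δ-≢0E (λ β≡0 → not-multiple 0 (trans β≡0 (sym (scaleE-zero M))))

  geomSmall-recurrence : ∀ β → geomSmall β - geomSmall (subE β M) ≡ δ β
  geomSmall-recurrence β with geomSmall-view β
  ... | inj₁ (g≡1 , zero , refl) =
    trans (cong₂ _-_ g≡1 (geomSmall-negative (subE (scaleE 0 M) M) below-0))
          (sym (trans (cong δ (scaleE-zero M)) (δ-0E {N})))
    where
    below-0 : lookup (subE (scaleE 0 M) M) j ℤ.< + 0
    below-0 = subst (ℤ._< + 0) (sym (trans (lookup-subE (scaleE 0 M) M j) (cong₂ ℤ._-_ (lookup-scaleE-M 0) M-j)))
                (subst (ℤ._< + 0) (sym (ℤP.+-identityˡ (ℤ.- + A))) (ℤP.neg-mono-< (ℤ.+<+ (ℕ.>-nonZero⁻¹ A))))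
  ... | inj₁ (g≡1 , suc k , refl) =
    trans (cong₂ _-_ g≡1 (trans (cong geomSmall (subE-scaleE-suc k M)) (geomSmall-scaleE k)))
          (sym (δ-≢0E nonzero))
    where
    nonzero : scaleE (suc k) M ≢ 0E
    nonzero eq with ℕP.m*n≡0⇒m≡0 (suc k) A
      (ℤP.+-injective (trans (sym (lookup-scaleE-M (suc k))) (trans (cong (λ v → lookup v j) eq) (lookup-0E j))))
    ... | ()
  ... | inj₂ (g≡0 , not-multiple) = trans (cong₂ _-_ g≡0 previous≡0) (sym (δ-not-multiple not-multiple))
    where
    previous≡0 : geomSmall (subE β M) ≡ 0ℚ
    previous≡0 with geomSmall-view (subE β M)
    ... | inj₂ (g≡0 , _) = g≡0
    ... | inj₁ (_ , k , eq) = contradiction (subE≡scaleE β M k eq) (not-multiple (suc k))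

  geomLarge-recurrence : ∀ β → geomLarge β - geomLarge (subE β M) ≡ δ β
  geomLarge-recurrence β = begin
    - geomSmall (subE (negE β) M) - (- geomSmall (subE (negE (subE β M)) M))
      ≡⟨ cong (λ z → - geomSmall (subE (negE β) M) - (- geomSmall z)) (subE-negE-subE β M) ⟩
    - geomSmall (subE (negE β) M) - (- geomSmall (negE β))
      ≡⟨ flip (geomSmall (subE (negE β) M)) (geomSmall (negE β)) ⟩
    geomSmall (negE β) - geomSmall (subE (negE β) M)
      ≡⟨ geomSmall-recurrence (negE β) ⟩
    δ (negE β)
      ≡⟨ δ-negE β ⟩
    δ β ∎
    where
    open ≡-Reasoning
    flip : ∀ x y → - x - (- y) ≡ y - x
    flip = ℚ-solve 2 (λ x y → :- x :- (:- y) := y :- x) refl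

  geomSmall-nonpositive : ∀ γ → lookup γ j ℤ.≤ + 0 → geomSmall γ ≡ δ γ
  geomSmall-nonpositive γ γ-j≤0 with geomSmall-view γ
  ... | inj₂ (g≡0 , not-multiple) = trans g≡0 (sym (δ-not-multiple not-multiple))
  ... | inj₁ (g≡1 , k , refl) = trans g≡1 (sym (trans (cong δ kM≡0) δ-0E))
    where
    k≡0 : k ≡ 0
    k≡0 = ℕP.m*n≡0⇒m≡0 k A (ℕP.n≤0⇒n≡0 (ℤP.drop‿+≤+ (subst (ℤ._≤ + 0) (lookup-scaleE-M k) γ-j≤0)))
    kM≡0 : scaleE k M ≡ 0E
    kM≡0 = trans (cong (λ z → scaleE z M) k≡0) (scaleE-zero M)

  geomLarge-above : ∀ γ → ℤ.- + A ℤ.< lookup γ j → geomLarge γ ≡ 0ℚ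
  geomLarge-above γ -A<γ-j = cong -_ (geomSmall-negative (subE (negE γ) M) negative)
    where
    negative : lookup (subE (negE γ) M) j ℤ.< + 0
    negative = subst₂ ℤ._<_
      (sym (trans (lookup-subE (negE γ) M j) (cong₂ ℤ._-_ (lookup-map j (λ z → ℤ.- z) γ) M-j)))
      (ℤP.+-inverseˡ (lookup γ j))
      (ℤP.+-monoʳ-< (ℤ.- lookup γ j) -A<γ-j)

  geomSmall∈K : isSmall M ≡ true → InK geomSmall
  geomSmall∈K small = InK-ray M 0E small on-ray
    where
    on-ray : ∀ β → geomSmall β ≢ 0ℚ → ∃ λ k → β ≡ addE 0E (scaleE k M)
    on-ray β g≢0 with geomSmall-view β
    ... | inj₁ (_ , k , β≡) = k , trans β≡ (sym (addE-identityˡ (scaleE k M)))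
    ... | inj₂ (g≡0 , _) = contradiction g≡0 g≢0

  geomLarge∈K : isLarge M ≡ true → InK geomLarge
  geomLarge∈K large = InK-ray (negE M) (negE M) (isLarge⇒isSmall-negE M large) on-ray
    where
    on-ray : ∀ β → geomLarge β ≢ 0ℚ → ∃ λ k → β ≡ addE (negE M) (scaleE k (negE M))
    on-ray β g≢0 with geomSmall-view (subE (negE β) M)
    ... | inj₁ (_ , k , eq) = k , subE-negE≡scaleE β M k eq
    ... | inj₂ (g≡0 , _) = contradiction g≡0 (-x≢0⇒x≢0 _ g≢0)

  expansion : Bool → Ser N
  expansion true = geomSmall
  expansion false = geomLarge

  geom : Ser N
  geom = expansion (isSmall M)

  OneMinus-geom : ∀ β → act (OneMinus M) geom β ≡ δ β
  OneMinus-geom β = trans (act-OneMinus M geom β) (recurrence (isSmall M))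
    where
    recurrence : ∀ b → expansion b β - expansion b (subE β M) ≡ δ β
    recurrence true = geomSmall-recurrence β
    recurrence false = geomLarge-recurrence β

  geom∈K : InK geom
  geom∈K = in-K (isSmall M) refl
    where
    M-j≢0 : lookup M j ≢ + 0
    M-j≢0 eq = ℕ.≢-nonZero⁻¹ A (ℤP.+-injective (trans (sym M-j) eq))
    in-K : ∀ b → isSmall M ≡ b → InK (expansion b)
    in-K true small = geomSmall∈K small
    in-K false ¬small = geomLarge∈K (¬isSmall⇒isLarge M j M-j≢0 ¬small)

  geom-near-0 : ∀ γ → lookup γ j ℤ.≤ + 0 → ℤ.- + A ℤ.< lookup γ j → geom γ ≡ χ (isSmall M) * δ γ
  geom-near-0 γ γ-j≤0 -A<γ-j = near-0 (isSmall M)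
    where
    near-0 : ∀ b → expansion b γ ≡ χ b * δ γ
    near-0 true = trans (geomSmall-nonpositive γ γ-j≤0) (sym (ℚP.*-identityˡ (δ γ)))
    near-0 false = trans (geomLarge-above γ -A<γ-j) (sym (ℚP.*-zeroˡ (δ γ)))

module Degrees {N} (j : Fin N) where

  SuppIn : (ℤ → Set) → Ser N → Set
  SuppIn R F = ∀ γ → F γ ≢ 0ℚ → R (lookup γ j)

  Supp≥ Supp≤ : ℤ → Ser N → Set
  Supp≥ t = SuppIn (t ℤ.≤_)
  Supp≤ t = SuppIn (ℤ._≤ t)

  SuppIn-cong : ∀ R {F G} → SuppIn R F → (∀ γ → F γ ≡ G γ) → SuppIn R G
  SuppIn-cong R supp F≗G γ G≢0 = supp γ (λ F≡0 → G≢0 (trans (sym (F≗G γ)) F≡0))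

  SuppIn-+ : ∀ R {F G} → SuppIn R F → SuppIn R G → SuppIn R (λ γ → F γ + G γ)
  SuppIn-+ R suppF suppG γ F+G≢0 with x+y≢0⇒x≢0⊎y≢0 _ _ F+G≢0
  ... | inj₁ F≢0 = suppF γ F≢0
  ... | inj₂ G≢0 = suppG γ G≢0

  SuppIn-sumℚ : ∀ R n (G : Fin n → Ser N) → (∀ i → SuppIn R (G i)) →
    SuppIn R (λ γ → sumℚ n (λ i → G i γ))
  SuppIn-sumℚ R zero G _ γ 0≢0 = contradiction refl 0≢0
  SuppIn-sumℚ R (suc n) G supp =
    SuppIn-+ R (supp F.zero) (SuppIn-sumℚ R n (λ i → G (F.suc i)) (λ i → supp (F.suc i)))

  SuppIn-outside : ∀ R {F} → SuppIn R F → ∀ γ → ¬ R (lookup γ j) → F γ ≡ 0ℚ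
  SuppIn-outside R supp γ ¬R = ≡0-stable _ (λ F≢0 → ¬R (supp γ F≢0))

  Supp≥-δ : Supp≥ (+ 0) δ
  Supp≥-δ γ δ≢0 = ℤP.≤-reflexive (sym (trans (cong (λ v → lookup v j) (δ≢0⇒≡0E γ δ≢0)) (lookup-0E j)))

  Supp≤-δ : Supp≤ (+ 0) δ
  Supp≤-δ γ δ≢0 = ℤP.≤-reflexive (trans (cong (λ v → lookup v j) (δ≢0⇒≡0E γ δ≢0)) (lookup-0E j))

  act-Supp≥ : ∀ (q : LPoly N) lo t F → (∀ m → coeff q m ≢ 0ℚ → lo ℤ.≤ lookup m j) →
    Supp≥ t F → Supp≥ (t ℤ.+ lo) (act q F)
  act-Supp≥ q lo t F q≥lo F≥t γ qF≢0 with (t ℤ.+ lo) ℤP.≤? lookup γ j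
  ... | yes ≤γ = ≤γ
  ... | no ≰γ = contradiction (act-local-0 q F γ λ m q≢0 → ≡0-stable _ λ F≢0 →
          ≰γ (add (subst (t ℤ.≤_) (lookup-subE γ m j) (F≥t _ F≢0)) (q≥lo m q≢0))) qF≢0
    where
    add : ∀ {x y} → t ℤ.≤ x ℤ.- y → lo ℤ.≤ y → t ℤ.+ lo ℤ.≤ x
    add {x} {y} t≤ lo≤ = subst (t ℤ.+ lo ℤ.≤_) (i-j+j≡i x y) (ℤP.+-mono-≤ t≤ lo≤)

  act-Supp≤ : ∀ (q : LPoly N) hi t F → (∀ m → coeff q m ≢ 0ℚ → lookup m j ℤ.≤ hi) →
    Supp≤ t F → Supp≤ (t ℤ.+ hi) (act q F)
  act-Supp≤ q hi t F q≤hi F≤t γ qF≢0 with lookup γ j ℤP.≤? (t ℤ.+ hi)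
  ... | yes γ≤ = γ≤
  ... | no γ≰ = contradiction (act-local-0 q F γ λ m q≢0 → ≡0-stable _ λ F≢0 →
          γ≰ (add (subst (ℤ._≤ t) (lookup-subE γ m j) (F≤t _ F≢0)) (q≤hi m q≢0))) qF≢0
    where
    add : ∀ {x y} → x ℤ.- y ℤ.≤ t → y ℤ.≤ hi → x ℤ.≤ t ℤ.+ hi
    add {x} {y} ≤t ≤hi = subst (ℤ._≤ t ℤ.+ hi) (i-j+j≡i x y) (ℤP.+-mono-≤ ≤t ≤hi)

  act≡0⇒≡0-onSlice : ∀ (c : LPoly N) → FreeOf j c → Nonzero c → ∀ (F : Ser N) → InK F → ∀ s →
    (∀ γ → lookup γ j ≡ s → act c F γ ≡ 0ℚ) → ∀ γ → lookup γ j ≡ s → F γ ≡ 0ℚ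
  act≡0⇒≡0-onSlice c c-free c≢0 F F∈K s cF≡0 γ γ-j =
    trans (sym (if-yes (lookup γ j ℤ.≟ s) γ-j)) (act≡0⇒≡0 c c≢0 F-on-s F-on-s∈K cF-on-s≡0 γ)
    where
    F-on-s : Ser N
    F-on-s γ = if ⌊ lookup γ j ℤ.≟ s ⌋ then F γ else 0ℚ
    F-on-s∈K : InK F-on-s
    F-on-s∈K = InK-⊆ F∈K λ γ ≢0 F≡0 → ≢0 (restricted-0 (lookup γ j ℤ.≟ s) F≡0)
      where
      restricted-0 : ∀ {P : Set} {x} (d : Dec P) → x ≡ 0ℚ → (if ⌊ d ⌋ then x else 0ℚ) ≡ 0ℚ
      restricted-0 (yes _) x≡0 = x≡0
      restricted-0 (no _) _ = refl
    cF-on-s≡0 : ∀ γ → act c F-on-s γ ≡ 0ℚ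
    cF-on-s≡0 γ with lookup γ j ℤ.≟ s
    ... | yes γ-j≡s = trans (act-local c F-on-s F γ λ m c≢0 →
                        if-yes (lookup (subE γ m) j ℤ.≟ s)
                               (trans (lookup-subE-free γ m j (c-free m c≢0)) γ-j≡s))
                            (cF≡0 γ γ-j≡s)
    ... | no γ-j≢s = act-local-0 c F-on-s γ λ m c≢0 →
                       if-no (lookup (subE γ m) j ℤ.≟ s)
                             (λ e → γ-j≢s (trans (sym (lookup-subE-free γ m j (c-free m c≢0))) e))

  -- q is a polynomial in x_j with constant term 1, expressed through its action.
  LowestTermOne : LPoly N → Set
  LowestTermOne q = ∀ t F → Supp≥ t F → Supp≥ t (act q F) × (∀ γ → lookup γ j ≡ t → act q F γ ≡ F γ)

  LowestTermOne-one : LowestTermOne one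
  LowestTermOne-one t F F≥t = SuppIn-cong (t ℤ.≤_) F≥t (λ γ → sym (act-one F γ)) , λ γ _ → act-one F γ

  LowestTermOne-OneMinus : ∀ (M : Exp N) A → lookup M j ≡ + suc A → LowestTermOne (OneMinus M)
  LowestTermOne-OneMinus M A M-j t F F≥t =
    SuppIn-cong (t ℤ.≤_) supp (λ γ → sym (act-OneMinus M F γ)) , lowest
    where
    shifted-j : ∀ γ → lookup (subE γ M) j ≡ lookup γ j ℤ.- + suc A
    shifted-j γ = trans (lookup-subE γ M j) (cong (λ z → lookup γ j ℤ.- z) M-j)
    i-suc<i : ∀ i → i ℤ.- + suc A ℤ.< i
    i-suc<i i = subst (i ℤ.- + suc A ℤ.<_) (i-j+j≡i i (+ suc A)) (i<i+suc (i ℤ.- + suc A) A)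
    supp : Supp≥ t (λ γ → F γ - F (subE γ M))
    supp γ ≢0 with x+y≢0⇒x≢0⊎y≢0 _ _ ≢0
    ... | inj₁ F≢0 = F≥t γ F≢0
    ... | inj₂ -F≢0 = ℤP.≤-trans (subst (t ℤ.≤_) (shifted-j γ) (F≥t _ (-x≢0⇒x≢0 _ -F≢0)))
                                 (ℤP.<⇒≤ (i-suc<i (lookup γ j)))
    lowest : ∀ γ → lookup γ j ≡ t → act (OneMinus M) F γ ≡ F γ
    lowest γ γ-j = trans (act-OneMinus M F γ) (trans (cong (λ z → F γ - z) shifted≡0) (ℚP.+-identityʳ (F γ)))
      where
      shifted≡0 : F (subE γ M) ≡ 0ℚ
      shifted≡0 = SuppIn-outside (t ℤ.≤_) F≥t (subE γ M)
        (ℤP.<⇒≱ (subst (ℤ._< t) (sym (trans (shifted-j γ) (cong (ℤ._- + suc A) γ-j))) (i-suc<i t)))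

  LowestTermOne-⊗ : ∀ q₁ q₂ → LowestTermOne q₁ → LowestTermOne q₂ → LowestTermOne (q₁ ⊗ q₂)
  LowestTermOne-⊗ q₁ q₂ low₁ low₂ t F F≥t =
    let q₂F≥t , q₂F-lowest = low₂ t F F≥t
        q₁q₂F≥t , q₁q₂F-lowest = low₁ t (act q₂ F) q₂F≥t
    in SuppIn-cong (t ℤ.≤_) q₁q₂F≥t (λ γ → sym (act-⊗ q₁ q₂ F γ)) ,
       λ γ γ-j → trans (act-⊗ q₁ q₂ F γ) (trans (q₁q₂F-lowest γ γ-j) (q₂F-lowest γ γ-j))

  LowestTermOne-prodP : ∀ n (G : Fin n → LPoly N) → (∀ i → LowestTermOne (G i)) → LowestTermOne (prodP n G)
  LowestTermOne-prodP zero G _ = LowestTermOne-one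
  LowestTermOne-prodP (suc n) G low =
    LowestTermOne-⊗ (G F.zero) _ (low F.zero) (LowestTermOne-prodP n (λ i → G (F.suc i)) (λ i → low (F.suc i)))

  LowestTermOne-δ : ∀ q → LowestTermOne q → ∀ γ → lookup γ j ℤ.≤ + 0 → act q δ γ ≡ δ γ
  LowestTermOne-δ q low γ γ-j≤0 with lookup γ j ℤ.≟ + 0
  ... | yes γ-j≡0 = proj₂ (low (+ 0) δ Supp≥-δ) γ γ-j≡0
  ... | no γ-j≢0 = trans (SuppIn-outside (+ 0 ℤ.≤_) (proj₁ (low (+ 0) δ Supp≥-δ)) γ γ-j≱0)
                         (sym (SuppIn-outside (+ 0 ℤ.≤_) Supp≥-δ γ γ-j≱0))
    where
    γ-j≱0 : ¬ (+ 0 ℤ.≤ lookup γ j)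
    γ-j≱0 0≤ = γ-j≢0 (ℤP.≤-antisym γ-j≤0 0≤)

  -- q has x_j-degree d and its part of top degree is a single monomial σ x^μ.
  LeadingMonomial : LPoly N → ℕ → Set
  LeadingMonomial q d = Σ ℚ λ σ → σ ≢ 0ℚ × Σ (Exp N) λ μ → lookup μ j ≡ + d ×
    (∀ t F → Supp≤ t F → Supp≤ (t ℤ.+ + d) (act q F) ×
                         (∀ γ → lookup γ j ≡ t ℤ.+ + d → act q F γ ≡ σ * F (subE γ μ)))

  LeadingMonomial-Supp≤ : ∀ q d → LeadingMonomial q d → ∀ t F → Supp≤ t F → Supp≤ (t ℤ.+ + d) (act q F)
  LeadingMonomial-Supp≤ q d (_ , _ , _ , _ , lead) t F F≤t = proj₁ (lead t F F≤t)

  LeadingMonomial-top-slice : ∀ q d → LeadingMonomial q d → ∀ s F → Supp≤ s F →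
    (∀ γ → lookup γ j ≡ s ℤ.+ + d → act q F γ ≡ 0ℚ) → ∀ m → lookup m j ≡ s → F m ≡ 0ℚ
  LeadingMonomial-top-slice q d (σ , σ≢0 , μ , μ-j , lead) s F F≤s qF≡0 m m-j = x*y≡0⇒y≡0 σ (F m) σ≢0 (begin
    σ * F m                     ≡⟨ cong (λ v → σ * F v) (subE-addE-cancel m μ) ⟨
    σ * F (subE (addE m μ) μ)   ≡⟨ proj₂ (lead s F F≤s) (addE m μ) mμ-j ⟨
    act q F (addE m μ)          ≡⟨ qF≡0 (addE m μ) mμ-j ⟩
    0ℚ                          ∎)
    where
    open ≡-Reasoning
    mμ-j : lookup (addE m μ) j ≡ s ℤ.+ + d
    mμ-j = trans (lookup-addE m μ j) (cong₂ ℤ._+_ m-j μ-j)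

  LeadingMonomial-one : LeadingMonomial one 0
  LeadingMonomial-one = 1ℚ , (λ ()) , 0E , lookup-0E j , λ t F F≤t →
    SuppIn-cong (ℤ._≤ t ℤ.+ + 0) (subst (λ z → Supp≤ z F) (sym (ℤP.+-identityʳ t)) F≤t)
                (λ γ → sym (act-one F γ)) ,
    λ γ _ → trans (act-one F γ) (trans (cong F (sym (subE-identityʳ γ))) (sym (ℚP.*-identityˡ _)))

  LeadingMonomial-OneMinus : ∀ (M : Exp N) A → lookup M j ≡ + suc A → LeadingMonomial (OneMinus M) (suc A)
  LeadingMonomial-OneMinus M A M-j = - 1ℚ , (λ ()) , M , M-j , λ t F F≤t →
    SuppIn-cong (ℤ._≤ t ℤ.+ + suc A) (supp t F F≤t) (λ γ → sym (act-OneMinus M F γ)) , top t F F≤t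
    where
    shifted-j : ∀ γ → lookup (subE γ M) j ≡ lookup γ j ℤ.- + suc A
    shifted-j γ = trans (lookup-subE γ M j) (cong (λ z → lookup γ j ℤ.- z) M-j)
    supp : ∀ t F → Supp≤ t F → Supp≤ (t ℤ.+ + suc A) (λ γ → F γ - F (subE γ M))
    supp t F F≤t γ ≢0 with x+y≢0⇒x≢0⊎y≢0 _ _ ≢0
    ... | inj₁ F≢0 = ℤP.≤-trans (F≤t γ F≢0) (ℤP.i≤i+j t (+ suc A))
    ... | inj₂ -F≢0 = subst (ℤ._≤ t ℤ.+ + suc A) (i-j+j≡i (lookup γ j) (+ suc A))
        (ℤP.+-monoˡ-≤ (+ suc A) (subst (ℤ._≤ t) (shifted-j γ) (F≤t _ (-x≢0⇒x≢0 _ -F≢0))))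
    top : ∀ t F → Supp≤ t F → ∀ γ → lookup γ j ≡ t ℤ.+ + suc A →
      act (OneMinus M) F γ ≡ - 1ℚ * F (subE γ M)
    top t F F≤t γ γ-j = trans (act-OneMinus M F γ) (trans (cong (_- F (subE γ M)) F≡0) (negate (F (subE γ M))))
      where
      negate : ∀ x → 0ℚ - x ≡ - 1ℚ * x
      negate = ℚ-solve 1 (λ x → con 0ℚ :- x := :- con 1ℚ :* x) refl
      F≡0 : F γ ≡ 0ℚ
      F≡0 = SuppIn-outside (ℤ._≤ t) F≤t γ (ℤP.<⇒≱ (subst (t ℤ.<_) (sym γ-j) (i<i+suc t A)))

  LeadingMonomial-⊗ : ∀ q₁ q₂ d₁ d₂ → LeadingMonomial q₁ d₁ → LeadingMonomial q₂ d₂ →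
    LeadingMonomial (q₁ ⊗ q₂) (d₁ ℕ.+ d₂)
  LeadingMonomial-⊗ q₁ q₂ d₁ d₂ (σ₁ , σ₁≢0 , μ₁ , μ₁-j , lead₁) (σ₂ , σ₂≢0 , μ₂ , μ₂-j , lead₂) =
    σ₁ * σ₂ , x*y≢0 σ₁ σ₂ σ₁≢0 σ₂≢0 , addE μ₁ μ₂ , μ-j , λ t F F≤t →
      let q₂F≤ , q₂F-top = lead₂ t F F≤t
          q₁q₂F≤ , q₁q₂F-top = lead₁ (t ℤ.+ + d₂) (act q₂ F) q₂F≤
      in SuppIn-cong (ℤ._≤ t ℤ.+ + (d₁ ℕ.+ d₂)) (subst (λ z → Supp≤ z (act q₁ (act q₂ F))) (degree t) q₁q₂F≤)
                     (λ γ → sym (act-⊗ q₁ q₂ F γ)) ,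
         λ γ γ-j → begin
           act (q₁ ⊗ q₂) F γ                   ≡⟨ act-⊗ q₁ q₂ F γ ⟩
           act q₁ (act q₂ F) γ                 ≡⟨ q₁q₂F-top γ (trans γ-j (sym (degree t))) ⟩
           σ₁ * act q₂ F (subE γ μ₁)           ≡⟨ cong (σ₁ *_) (q₂F-top (subE γ μ₁) (inner-j t γ γ-j)) ⟩
           σ₁ * (σ₂ * F (subE (subE γ μ₁) μ₂)) ≡⟨ ℚP.*-assoc σ₁ σ₂ _ ⟨
           σ₁ * σ₂ * F (subE (subE γ μ₁) μ₂)   ≡⟨ cong (λ v → σ₁ * σ₂ * F v) (subE-addE γ μ₁ μ₂) ⟨
           σ₁ * σ₂ * F (subE γ (addE μ₁ μ₂))   ∎
    where
    open ≡-Reasoning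
    regroup : ∀ t a b → t ℤ.+ b ℤ.+ a ≡ t ℤ.+ (a ℤ.+ b)
    regroup = solve-∀
    degree : ∀ t → t ℤ.+ + d₂ ℤ.+ + d₁ ≡ t ℤ.+ + (d₁ ℕ.+ d₂)
    degree t = trans (regroup t (+ d₁) (+ d₂)) (cong (λ z → t ℤ.+ z) (sym (ℤP.pos-+ d₁ d₂)))
    inner-j : ∀ t γ → lookup γ j ≡ t ℤ.+ + (d₁ ℕ.+ d₂) → lookup (subE γ μ₁) j ≡ t ℤ.+ + d₂
    inner-j t γ γ-j = trans (lookup-subE γ μ₁ j)
      (trans (cong₂ ℤ._-_ (trans γ-j (sym (degree t))) μ₁-j) (i+j-j≡i (t ℤ.+ + d₂) (+ d₁)))
    μ-j : lookup (addE μ₁ μ₂) j ≡ + (d₁ ℕ.+ d₂)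
    μ-j = trans (lookup-addE μ₁ μ₂ j) (trans (cong₂ ℤ._+_ μ₁-j μ₂-j) (sym (ℤP.pos-+ d₁ d₂)))

  LeadingMonomial-prodP : ∀ n (G : Fin n → LPoly N) (d : Fin n → ℕ) → (∀ i → LeadingMonomial (G i) (d i)) →
    LeadingMonomial (prodP n G) (sumℕ n d)
  LeadingMonomial-prodP zero G d _ = LeadingMonomial-one
  LeadingMonomial-prodP (suc n) G d lead =
    LeadingMonomial-⊗ (G F.zero) _ (d F.zero) _ (lead F.zero)
      (LeadingMonomial-prodP n (λ i → G (F.suc i)) (λ i → d (F.suc i)) (λ i → lead (F.suc i)))

omit : ∀ {n} {A : Set} → A → Fin n → (Fin n → A) → Fin n → A
omit unit i G i' = if ⌊ i FP.≟ i' ⌋ then unit else G i'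

omit-suc : ∀ {n} {A : Set} (unit : A) (i : Fin n) G i' →
  omit unit (F.suc i) G (F.suc i') ≡ omit unit i (λ k → G (F.suc k)) i'
omit-suc unit i G i' with i FP.≟ i'
... | yes _ = refl
... | no _ = refl

prodP-cong : ∀ {N} n {G G' : Fin n → LPoly N} → (∀ i → G i ≡ G' i) → prodP n G ≡ prodP n G'
prodP-cong zero _ = refl
prodP-cong (suc n) G≗G' = cong₂ _⊗_ (G≗G' F.zero) (prodP-cong n (λ i → G≗G' (F.suc i)))

sumℕ-cong : ∀ n {d d' : Fin n → ℕ} → (∀ i → d i ≡ d' i) → sumℕ n d ≡ sumℕ n d'
sumℕ-cong zero _ = refl
sumℕ-cong (suc n) d≗d' = cong₂ ℕ._+_ (d≗d' F.zero) (sumℕ-cong n (λ i → d≗d' (F.suc i)))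

act-prodP-omit : ∀ {N} n (G : Fin n → LPoly N) i F β →
  act (prodP n G) F β ≡ act (prodP n (omit one i G)) (act (G i) F) β
act-prodP-omit {N} (suc n) G F.zero F β = begin
  act (G F.zero ⊗ rest) F β           ≡⟨ act-⊗ (G F.zero) rest F β ⟩
  act (G F.zero) (act rest F) β       ≡⟨ act-comm (G F.zero) rest F β ⟩
  act rest (act (G F.zero) F) β       ≡⟨ act-one (act rest (act (G F.zero) F)) β ⟨
  act one (act rest (act (G F.zero) F)) β ≡⟨ act-⊗ one rest (act (G F.zero) F) β ⟨
  act (one ⊗ rest) (act (G F.zero) F) β ∎
  where
  open ≡-Reasoning
  rest : LPoly N
  rest = prodP n (λ i → G (F.suc i))
act-prodP-omit {N} (suc n) G (F.suc i) F β = begin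
  act (G F.zero ⊗ rest) F β
    ≡⟨ act-⊗ (G F.zero) rest F β ⟩
  act (G F.zero) (act rest F) β
    ≡⟨ act-cong (G F.zero) (λ γ → act-prodP-omit n (λ k → G (F.suc k)) i F γ) β ⟩
  act (G F.zero) (act rest-omit (act (G (F.suc i)) F)) β
    ≡⟨ act-⊗ (G F.zero) rest-omit (act (G (F.suc i)) F) β ⟨
  act (G F.zero ⊗ rest-omit) (act (G (F.suc i)) F) β
    ≡⟨ cong (λ r → act (G F.zero ⊗ r) (act (G (F.suc i)) F) β)
            (prodP-cong n (λ i' → sym (omit-suc one i G i'))) ⟩
  act (prodP (suc n) (omit one (F.suc i) G)) (act (G (F.suc i)) F) β ∎
  where
  open ≡-Reasoning
  rest rest-omit : LPoly N
  rest = prodP n (λ k → G (F.suc k))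
  rest-omit = prodP n (omit one i (λ k → G (F.suc k)))

sumℕ-omit : ∀ n (d : Fin n → ℕ) i → sumℕ n (omit 0 i d) ℕ.+ d i ≡ sumℕ n d
sumℕ-omit (suc n) d F.zero = ℕP.+-comm _ (d F.zero)
sumℕ-omit (suc n) d (F.suc i) = begin
  d F.zero ℕ.+ sumℕ n (λ i' → omit 0 (F.suc i) d (F.suc i')) ℕ.+ d (F.suc i)
    ≡⟨ cong (λ z → d F.zero ℕ.+ z ℕ.+ d (F.suc i)) (sumℕ-cong n (omit-suc 0 i d)) ⟩
  d F.zero ℕ.+ sumℕ n (omit 0 i (λ k → d (F.suc k))) ℕ.+ d (F.suc i)
    ≡⟨ ℕP.+-assoc (d F.zero) _ (d (F.suc i)) ⟩
  d F.zero ℕ.+ (sumℕ n (omit 0 i (λ k → d (F.suc k))) ℕ.+ d (F.suc i))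
    ≡⟨ cong (d F.zero ℕ.+_) (sumℕ-omit n (λ k → d (F.suc k)) i) ⟩
  sumℕ (suc n) d ∎
  where open ≡-Reasoning

prodP-act≡0⇒≡0 : ∀ {N} n (G : Fin n → LPoly N) → (∀ i → Nonzero (G i)) → ∀ F → InK F →
  (∀ β → act (prodP n G) F β ≡ 0ℚ) → ∀ β → F β ≡ 0ℚ
prodP-act≡0⇒≡0 zero G _ F _ GF≡0 β = trans (sym (act-one F β)) (GF≡0 β)
prodP-act≡0⇒≡0 (suc n) G G≢0 F F∈K GF≡0 =
  prodP-act≡0⇒≡0 n (λ i → G (F.suc i)) (λ i → G≢0 (F.suc i)) F F∈K
    (act≡0⇒≡0 (G F.zero) (G≢0 F.zero) _ (InK-act (prodP n (λ i → G (F.suc i))) F∈K)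
      (λ β → trans (sym (act-⊗ (G F.zero) _ F β)) (GF≡0 β)))

module ConstantTerm {N : ℕ} (j : Fin N) (n : ℕ) (u : Fin n → Exp N) (a : Fin n → ℕ)
  (a≥1 : ∀ i → 1 ℕ.≤ a i)
  (Nm c : LPoly N) (c-free : FreeOf j c) (c≢0 : Nonzero c)
  (f : Ser N) (f∈K : InK f) (f-expands : ∀ β → act (c ⊗ Den j n u a) f β ≡ coeff Nm β)
  (D : LPoly N) (k : ℕ) (P p : LPoly N) (B : Fin n → LPoly N)
  (D-free : FreeOf j D) (P-poly : PolyIn j P) (p-poly : PolyIn j p) (p-deg : DegLt j p (+ k))
  (B-deg : ∀ i → PolyIn j (B i) × DegLt j (B i) (+ a i))
  (partial-fractions : xpow j k ⊗ D ⊗ Nm ≈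
     c ⊗ ((xpow j k ⊗ P ⊕ p) ⊗ Den j n u a ⊕ xpow j k ⊗ sumP n (λ i → B i ⊗ DenExcept j n u a i)))
  where

  open Degrees j

  M : Fin n → Exp N
  M = uxa j u a

  Denom : LPoly N
  Denom = Den j n u a

  DenomExcept : Fin n → LPoly N
  DenomExcept = DenExcept j n u a

  M-j : ∀ i → lookup (M i) j ≡ + a i
  M-j i = lookup∘update j (u i) (+ a i)

  instance
    a≢0 : ∀ {i} → ℕ.NonZero (a i)
    a≢0 {i} = ℕ.>-nonZero (a≥1 i)

  M-j≡suc : ∀ i → lookup (M i) j ≡ + suc (ℕ.pred (a i))
  M-j≡suc i = trans (M-j i) (cong +_ (sym (ℕP.suc-pred (a i))))

  M-j≢0 : ∀ i → lookup (M i) j ≢ + 0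
  M-j≢0 i eq with trans (sym (M-j≡suc i)) eq
  ... | ()

  Fac≢0 : ∀ i → Nonzero (Fac j u a i)
  Fac≢0 i = 0E , λ c≡0 → ℚP.1≢0 (trans (sym coeff-0E) c≡0)
    where
    coeff-0E : coeff (Fac j u a i) 0E ≡ 1ℚ
    coeff-0E = begin
      coeff (Fac j u a i) 0E        ≡⟨ act-δ (Fac j u a i) 0E ⟨
      act (OneMinus (M i)) δ 0E     ≡⟨ act-OneMinus (M i) δ (0E {N}) ⟩
      δ {N} 0E - δ (subE 0E (M i))  ≡⟨ cong₂ _-_ (δ-0E {N}) (δ-≢0E M≠0) ⟩
      1ℚ - 0ℚ                       ≡⟨⟩
      1ℚ                            ∎
      where
      open ≡-Reasoning
      M≠0 : subE 0E (M i) ≢ 0E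
      M≠0 eq = M-j≢0 i (trans (cong (λ v → lookup v j) (subE≡0E⇒≡ 0E (M i) eq)) (lookup-0E j))

  g : Fin n → Ser N
  g i = Geometric.geom j (a i) (M i) (M-j i)

  χs χl : Fin n → ℚ
  χs i = χ (isSmall (M i))
  χl i = χ (isLarge (M i))

  xᵏ x⁻ᵏ : LPoly N
  xᵏ = xpow j k
  x⁻ᵏ = mono 1ℚ (0E [ j ]≔ ℤ.- + k)

  x⁻ᵏ-xᵏ : ∀ F β → act x⁻ᵏ (act xᵏ F) β ≡ F β
  x⁻ᵏ-xᵏ F β = trans (act-mono _ (act xᵏ F) β) (trans (act-mono _ F _)
                 (cong F (subE-update-cancel j (ℤ.- + k) (+ k) β (ℤP.+-inverseˡ (+ k)))))

  den : Ser N
  den = act Denom δ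

  denExcept : Fin n → Ser N
  denExcept i = act (DenomExcept i) δ

  -- Over the common denominator c ∏ (1 - u_i x^{a_i}) the partial fraction sum has
  -- numerator P Den + x^{-k} p Den + Σ_i B_i DenExcept_i, which is D Nm / c.
  numerPoly numerPolar numerFactors numer : Ser N
  numerPoly γ = act P den γ
  numerPolar γ = act x⁻ᵏ (act p den) γ
  numerFactors γ = sumℚ n (λ i → act (B i) (denExcept i) γ)
  numer γ = numerPoly γ + numerPolar γ + numerFactors γ

  xᵏnumer : Ser N
  xᵏnumer γ = act xᵏ numerPoly γ + act p den γ + act xᵏ numerFactors γ

  xᵏnumer-δ : ∀ γ →
    act ((xᵏ ⊗ P ⊕ p) ⊗ Denom ⊕ xᵏ ⊗ sumP n (λ i → B i ⊗ DenomExcept i)) δ γ ≡ xᵏnumer γ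
  xᵏnumer-δ γ = trans (act-⊕ ((xᵏ ⊗ P ⊕ p) ⊗ Denom) (xᵏ ⊗ factors) δ γ)
    (cong₂ _+_ (trans (act-⊗ (xᵏ ⊗ P ⊕ p) Denom δ γ)
                      (trans (act-⊕ (xᵏ ⊗ P) p den γ) (cong (_+ act p den γ) (act-⊗ xᵏ P den γ))))
               (trans (act-⊗ xᵏ factors δ γ) (act-cong xᵏ factors-δ γ)))
    where
    factors : LPoly N
    factors = sumP n (λ i → B i ⊗ DenomExcept i)
    factors-δ : ∀ γ → act factors δ γ ≡ numerFactors γ
    factors-δ γ = trans (act-sumP n (λ i → B i ⊗ DenomExcept i) δ γ)
                        (sumℚ-cong n (λ i → act-⊗ (B i) (DenomExcept i) δ γ))

  xᵏ-D-Nm≡c-xᵏnumer : ∀ γ → act xᵏ (act D (coeff Nm)) γ ≡ act c xᵏnumer γ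
  xᵏ-D-Nm≡c-xᵏnumer γ = begin
    act xᵏ (act D (coeff Nm)) γ  ≡⟨ act-cong xᵏ (act-cong D (λ γ' → sym (act-δ Nm γ'))) γ ⟩
    act xᵏ (act D (act Nm δ)) γ  ≡⟨ act-⊗ xᵏ D (act Nm δ) γ ⟨
    act (xᵏ ⊗ D) (act Nm δ) γ    ≡⟨ act-⊗ (xᵏ ⊗ D) Nm δ γ ⟨
    act (xᵏ ⊗ D ⊗ Nm) δ γ        ≡⟨ act-δ (xᵏ ⊗ D ⊗ Nm) γ ⟩
    coeff (xᵏ ⊗ D ⊗ Nm) γ        ≡⟨ partial-fractions γ ⟩
    coeff (c ⊗ Q) γ              ≡⟨ act-coeff c Q γ ⟨
    act c (coeff Q) γ            ≡⟨ act-cong c (λ γ' → trans (sym (act-δ Q γ')) (xᵏnumer-δ γ')) γ ⟩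
    act c xᵏnumer γ              ∎
    where
    open ≡-Reasoning
    Q : LPoly N
    Q = (xᵏ ⊗ P ⊕ p) ⊗ Denom ⊕ xᵏ ⊗ sumP n (λ i → B i ⊗ DenomExcept i)

  x⁻ᵏ-xᵏnumer : ∀ γ → act x⁻ᵏ xᵏnumer γ ≡ numer γ
  x⁻ᵏ-xᵏnumer γ = trans (act-+ x⁻ᵏ (λ γ' → act xᵏ numerPoly γ' + act p den γ') (act xᵏ numerFactors) γ)
    (cong₂ _+_ (trans (act-+ x⁻ᵏ (act xᵏ numerPoly) (act p den) γ)
                      (cong (_+ numerPolar γ) (x⁻ᵏ-xᵏ numerPoly γ)))
               (x⁻ᵏ-xᵏ numerFactors γ))

  D-Nm≡c-numer : ∀ γ → act D (coeff Nm) γ ≡ act c numer γ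
  D-Nm≡c-numer γ = begin
    act D (coeff Nm) γ                    ≡⟨ x⁻ᵏ-xᵏ (act D (coeff Nm)) γ ⟨
    act x⁻ᵏ (act xᵏ (act D (coeff Nm))) γ ≡⟨ act-cong x⁻ᵏ xᵏ-D-Nm≡c-xᵏnumer γ ⟩
    act x⁻ᵏ (act c xᵏnumer) γ             ≡⟨ act-comm x⁻ᵏ c xᵏnumer γ ⟩
    act c (act x⁻ᵏ xᵏnumer) γ             ≡⟨ act-cong c x⁻ᵏ-xᵏnumer γ ⟩
    act c numer γ                         ∎
    where open ≡-Reasoning

  pfExpansion : Ser N
  pfExpansion γ = coeff P γ + act p (act x⁻ᵏ δ) γ + sumℚ n (λ i → act (B i) (g i) γ)

  Den-pfExpansion : ∀ γ → act Denom pfExpansion γ ≡ numer γ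
  Den-pfExpansion γ =
    trans (act-+ Denom (λ γ' → coeff P γ' + act p (act x⁻ᵏ δ) γ')
                       (λ γ' → sumℚ n (λ i → act (B i) (g i) γ')) γ)
          (cong₂ _+_ (trans (act-+ Denom (coeff P) (act p (act x⁻ᵏ δ)) γ) (cong₂ _+_ poly polar)) factors)
    where
    poly : act Denom (coeff P) γ ≡ numerPoly γ
    poly = trans (act-cong Denom (λ γ' → sym (act-δ P γ')) γ) (act-comm Denom P δ γ)
    polar : act Denom (act p (act x⁻ᵏ δ)) γ ≡ numerPolar γ
    polar = trans (act-comm Denom p (act x⁻ᵏ δ) γ)
                  (trans (act-cong p (act-comm Denom x⁻ᵏ δ) γ) (act-comm p x⁻ᵏ den γ))
    factors : act Denom (λ γ' → sumℚ n (λ i → act (B i) (g i) γ')) γ ≡ numerFactors γ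
    factors = trans (act-sumℚ Denom n (λ i → act (B i) (g i)) γ) (sumℚ-cong n λ i →
      trans (act-comm Denom (B i) (g i) γ)
            (act-cong (B i) (λ γ' → trans (act-prodP-omit n (Fac j u a) i (g i) γ')
                                          (act-cong (DenomExcept i) (Geometric.OneMinus-geom j (a i) (M i) (M-j i)) γ')) γ))

  c-Den-D-f : ∀ γ → act c (act Denom (act D f)) γ ≡ act D (coeff Nm) γ
  c-Den-D-f γ = begin
    act c (act Denom (act D f)) γ   ≡⟨ act-cong c (act-comm Denom D f) γ ⟩
    act c (act D (act Denom f)) γ   ≡⟨ act-comm c D (act Denom f) γ ⟩
    act D (act c (act Denom f)) γ   ≡⟨ act-cong D (λ γ' → trans (sym (act-⊗ c Denom f γ')) (f-expands γ')) γ ⟩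
    act D (coeff Nm) γ             ∎
    where
    open ≡-Reasoning

  D-f≡pfExpansion : ∀ γ → act D f γ ≡ pfExpansion γ
  D-f≡pfExpansion γ = begin
    act D f γ                                  ≡⟨ x≡x-y+y (act D f γ) (pfExpansion γ) ⟩
    (act D f γ - pfExpansion γ) + pfExpansion γ ≡⟨ cong (_+ pfExpansion γ) (difference≡0 γ) ⟩
    0ℚ + pfExpansion γ                         ≡⟨ ℚP.+-identityˡ (pfExpansion γ) ⟩
    pfExpansion γ                              ∎
    where
    open ≡-Reasoning
    x≡x-y+y : ∀ x y → x ≡ (x - y) + y
    x≡x-y+y = ℚ-solve 2 (λ x y → x := (x :- y) :+ y) refl
    difference : Ser N
    difference γ = act D f γ - pfExpansion γ
    difference∈K : InK difference
    difference∈K = InK-sub (InK-act D f∈K)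
      (InK-+ (InK-+ (InK-coeff P) (InK-act p (InK-act x⁻ᵏ InK-δ)))
             (InK-sumℚ n (λ i → act (B i) (g i)) (λ i → InK-act (B i) (Geometric.geom∈K j (a i) (M i) (M-j i)))))
    c-Den-difference≡0 : ∀ γ → act c (act Denom difference) γ ≡ 0ℚ
    c-Den-difference≡0 γ = begin
      act c (act Denom difference) γ
        ≡⟨ act-cong c (act-sub Denom (act D f) pfExpansion) γ ⟩
      act c (λ γ' → act Denom (act D f) γ' - act Denom pfExpansion γ') γ
        ≡⟨ act-sub c (act Denom (act D f)) (act Denom pfExpansion) γ ⟩
      act c (act Denom (act D f)) γ - act c (act Denom pfExpansion) γ
        ≡⟨ cong₂ _-_ (c-Den-D-f γ) (trans (act-cong c Den-pfExpansion γ) (sym (D-Nm≡c-numer γ))) ⟩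
      act D (coeff Nm) γ - act D (coeff Nm) γ
        ≡⟨ ℚP.+-inverseʳ (act D (coeff Nm) γ) ⟩
      0ℚ ∎
    difference≡0 : ∀ γ → difference γ ≡ 0ℚ
    difference≡0 = prodP-act≡0⇒≡0 n (Fac j u a) Fac≢0 difference difference∈K
                     (act≡0⇒≡0 c c≢0 (act Denom difference) (InK-act Denom difference∈K) c-Den-difference≡0)

  shift-from-x⁰ : ∀ γ m → lookup γ j ≡ + 0 → lookup (subE γ m) j ≡ ℤ.- lookup m j
  shift-from-x⁰ γ m γ-j = trans (lookup-subE γ m j) (trans (cong (ℤ._- lookup m j) γ-j) (ℤP.+-identityˡ _))

  shift-from-x⁰-≤0 : ∀ γ m → lookup γ j ≡ + 0 → + 0 ℤ.≤ lookup m j → lookup (subE γ m) j ℤ.≤ + 0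
  shift-from-x⁰-≤0 γ m γ-j 0≤m-j = subst (ℤ._≤ + 0) (sym (shift-from-x⁰ γ m γ-j)) (ℤP.neg-mono-≤ 0≤m-j)

  polar-on-x⁰ : ∀ γ → lookup γ j ≡ + 0 → act p (act x⁻ᵏ δ) γ ≡ 0ℚ
  polar-on-x⁰ γ γ-j = act-local-0 p (act x⁻ᵏ δ) γ λ m p≢0 →
    trans (act-mono _ δ (subE γ m)) (δ-≢0E (λ eq → ℤP.<-irrefl (m-j≡k m eq) (p-deg m p≢0)))
    where
    m-j≡k : ∀ m → subE (subE γ m) (0E [ j ]≔ ℤ.- + k) ≡ 0E → lookup m j ≡ + k
    m-j≡k m eq = ℤP.neg-injective (ℤP.i-j≡0⇒i≡j _ _ (begin
      ℤ.- lookup m j ℤ.- ℤ.- + k                              ≡⟨ cong₂ ℤ._-_ (shift-from-x⁰ γ m γ-j) (lookup∘update j 0E (ℤ.- + k)) ⟨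
      lookup (subE γ m) j ℤ.- lookup (0E [ j ]≔ ℤ.- + k) j     ≡⟨ lookup-subE (subE γ m) _ j ⟨
      lookup (subE (subE γ m) (0E [ j ]≔ ℤ.- + k)) j           ≡⟨ cong (λ v → lookup v j) eq ⟩
      lookup 0E j                                              ≡⟨ lookup-0E j ⟩
      + 0                                                      ∎))
      where open ≡-Reasoning

  Bg-on-x⁰ : ∀ i γ → lookup γ j ≡ + 0 → act (B i) (g i) γ ≡ χs i * coeff (B i) γ
  Bg-on-x⁰ i γ γ-j = begin
    act (B i) (g i) γ                      ≡⟨ act-local (B i) (g i) (λ γ' → χs i * δ γ') γ near-0 ⟩
    act (B i) (λ γ' → χs i * δ γ') γ       ≡⟨ act-* (B i) (χs i) δ γ ⟩
    χs i * act (B i) δ γ                   ≡⟨ cong (χs i *_) (act-δ (B i) γ) ⟩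
    χs i * coeff (B i) γ                   ∎
    where
    open ≡-Reasoning
    near-0 : ∀ m → coeff (B i) m ≢ 0ℚ → g i (subE γ m) ≡ χs i * δ (subE γ m)
    near-0 m B≢0 = Geometric.geom-near-0 j (a i) (M i) (M-j i) (subE γ m)
      (shift-from-x⁰-≤0 γ m γ-j (proj₁ (B-deg i) m B≢0))
      (subst (ℤ.- + a i ℤ.<_) (sym (shift-from-x⁰ γ m γ-j)) (ℤP.neg-mono-< (proj₂ (B-deg i) m B≢0)))

  pfExpansion-on-x⁰ : ∀ γ → lookup γ j ≡ + 0 →
    pfExpansion γ ≡ coeff P γ + sumℚ n (λ i → χs i * coeff (B i) γ)
  pfExpansion-on-x⁰ γ γ-j =
    cong₂ _+_ (trans (+-congˡ (coeff P γ) (polar-on-x⁰ γ γ-j)) (ℚP.+-identityʳ (coeff P γ)))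
              (sumℚ-cong n (λ i → Bg-on-x⁰ i γ γ-j))

  free⇒0≤ : ∀ (q : LPoly N) → FreeOf j q → ∀ m → coeff q m ≢ 0ℚ → + 0 ℤ.≤ lookup m j
  free⇒0≤ q q-free m q≢0 = ℤP.≤-reflexive (sym (q-free m q≢0))

  free⇒≤0 : ∀ (q : LPoly N) → FreeOf j q → ∀ m → coeff q m ≢ 0ℚ → lookup m j ℤ.≤ + 0
  free⇒≤0 q q-free m q≢0 = ℤP.≤-reflexive (q-free m q≢0)

  act-c-on-x⁰ : ∀ F G β → lookup β j ≡ + 0 → (∀ γ → lookup γ j ≡ + 0 → F γ ≡ G γ) →
    act c F β ≡ act c G β
  act-c-on-x⁰ F G β β-j F≗G = act-local c F G β λ m c≢0 →
    F≗G (subE β m) (trans (lookup-subE-free β m j (c-free m c≢0)) β-j)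

  act-c-+sumℚ : ∀ F (G : Fin n → Ser N) β →
    act c (λ γ → F γ + sumℚ n (λ i → G i γ)) β ≡ act c F β + sumℚ n (λ i → act c (G i) β)
  act-c-+sumℚ F G β =
    trans (act-+ c F (λ γ → sumℚ n (λ i → G i γ)) β) (+-congˡ (act c F β) (act-sumℚ c n G β))

  sumℚ-by-size : ∀ (y : Fin n → ℚ) → sumℚ n y ≡ sumℚ n (λ i → χs i * y i) + sumℚ n (λ i → χl i * y i)
  sumℚ-by-size y = trans (sumℚ-cong n λ i → begin
      y i                      ≡⟨ ℚP.*-identityˡ (y i) ⟨
      1ℚ * y i                 ≡⟨ cong (_* y i) (χ-isSmall+χ-isLarge (M i) j (M-j≢0 i)) ⟨
      (χs i + χl i) * y i      ≡⟨ ℚP.*-distribʳ-+ (y i) (χs i) (χl i) ⟩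
      χs i * y i + χl i * y i  ∎)
    (sumℚ-+ n (λ i → χs i * y i) (λ i → χl i * y i))
    where open ≡-Reasoning

  Den-lowest : LowestTermOne Denom
  Den-lowest = LowestTermOne-prodP n (Fac j u a) (λ i → LowestTermOne-OneMinus (M i) _ (M-j≡suc i))

  DenExcept-lowest : ∀ i → LowestTermOne (DenomExcept i)
  DenExcept-lowest i = LowestTermOne-prodP n (omit one i (Fac j u a)) (λ i' → lowest (i FP.≟ i') i')
    where
    lowest : ∀ {P : Set} (d : Dec P) i' → LowestTermOne (if ⌊ d ⌋ then one else Fac j u a i')
    lowest (yes _) i' = LowestTermOne-one
    lowest (no _) i' = LowestTermOne-OneMinus (M i') _ (M-j≡suc i')

  numer-split : ∀ γ → act c numer γ ≡ act c numerPoly γ + act c numerPolar γ + act c numerFactors γ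
  numer-split γ = trans (act-+ c (λ γ' → numerPoly γ' + numerPolar γ') numerFactors γ)
                        (cong (_+ act c numerFactors γ) (act-+ c numerPoly numerPolar γ))

  module PolynomialNumerator (Nm-poly : PolyIn j Nm) where

    c-numerPoly≥0 : Supp≥ (+ 0) (act c numerPoly)
    c-numerPoly≥0 = act-Supp≥ c (+ 0) (+ 0) numerPoly (free⇒0≤ c c-free)
      (act-Supp≥ P (+ 0) (+ 0) den P-poly (proj₁ (Den-lowest (+ 0) δ Supp≥-δ)))

    c-numerFactors≥0 : Supp≥ (+ 0) (act c numerFactors)
    c-numerFactors≥0 = act-Supp≥ c (+ 0) (+ 0) numerFactors (free⇒0≤ c c-free)
      (SuppIn-sumℚ (+ 0 ℤ.≤_) n (λ i → act (B i) (denExcept i)) λ i →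
        act-Supp≥ (B i) (+ 0) (+ 0) (denExcept i) (proj₁ (B-deg i)) (proj₁ (DenExcept-lowest i (+ 0) δ Supp≥-δ)))

    D-Nm≥0 : Supp≥ (+ 0) (act D (coeff Nm))
    D-Nm≥0 = act-Supp≥ D (+ 0) (+ 0) (coeff Nm) (free⇒0≤ D D-free) Nm-poly

    negative⇒0 : ∀ {F : Ser N} → Supp≥ (+ 0) F → ∀ γ → lookup γ j ℤ.< + 0 → F γ ≡ 0ℚ
    negative⇒0 F≥0 γ γ-j<0 = SuppIn-outside (+ 0 ℤ.≤_) F≥0 γ (ℤP.<⇒≱ γ-j<0)

    -- In negative x-degree the other two parts of the numerator and D Nm vanish.
    c-numerPolar-negative : ∀ γ → lookup γ j ℤ.< + 0 → act c numerPolar γ ≡ 0ℚ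
    c-numerPolar-negative γ γ-j<0 = begin
      act c numerPolar γ                                           ≡⟨ pad (act c numerPolar γ) ⟩
      0ℚ + act c numerPolar γ + 0ℚ                                 ≡⟨ cong₂ _+_ (cong (_+ act c numerPolar γ)
                                                                        (sym (negative⇒0 c-numerPoly≥0 γ γ-j<0)))
                                                                        (sym (negative⇒0 c-numerFactors≥0 γ γ-j<0)) ⟩
      act c numerPoly γ + act c numerPolar γ + act c numerFactors γ ≡⟨ numer-split γ ⟨
      act c numer γ                                                ≡⟨ D-Nm≡c-numer γ ⟨
      act D (coeff Nm) γ                                           ≡⟨ negative⇒0 D-Nm≥0 γ γ-j<0 ⟩
      0ℚ                                                           ∎
      where
      open ≡-Reasoning
      pad : ∀ x → x ≡ 0ℚ + x + 0ℚ
      pad = ℚ-solve 1 (λ x → x := con 0ℚ :+ x :+ con 0ℚ) refl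

    numerPolar≡Den-p : ∀ γ → numerPolar (subE γ (0E [ j ]≔ + k)) ≡ act Denom (coeff p) γ
    numerPolar≡Den-p γ = begin
      act x⁻ᵏ (act p den) (subE γ xᵏE)                  ≡⟨ act-mono _ (act p den) (subE γ xᵏE) ⟩
      act p den (subE (subE γ xᵏE) x⁻ᵏE)               ≡⟨ cong (act p den) (subE-update-cancel j (+ k) (ℤ.- + k) γ (ℤP.+-inverseʳ (+ k))) ⟩
      act p den γ                                      ≡⟨ act-comm p Denom δ γ ⟩
      act Denom (act p δ) γ                    ≡⟨ act-cong Denom (act-δ p) γ ⟩
      act Denom (coeff p) γ                    ∎
      where
      open ≡-Reasoning
      xᵏE x⁻ᵏE : Exp N
      xᵏE = 0E [ j ]≔ + k
      x⁻ᵏE = 0E [ j ]≔ ℤ.- + k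

    -- Den has constant term 1, so on its lowest slice p agrees with Den p = x^k numerPolar,
    -- which vanishes in x-degree < k.
    p-on-degree : ∀ t → t ℕ.< k → Supp≥ (+ t) (coeff p) → ∀ m → lookup m j ≡ + t → coeff p m ≡ 0ℚ
    p-on-degree t t<k p≥t m m-j = begin
      coeff p m                                     ≡⟨ proj₂ (Den-lowest (+ t) (coeff p) p≥t) m m-j ⟨
      act Denom (coeff p) m                 ≡⟨ numerPolar≡Den-p m ⟨
      numerPolar (subE m (0E [ j ]≔ + k))           ≡⟨ act≡0⇒≡0-onSlice c c-free c≢0 numerPolar numerPolar∈K (+ t ℤ.- + k)
                                                         (λ γ γ-j → c-numerPolar-negative γ (subst (ℤ._< + 0) (sym γ-j) t-k<0))
                                                         _ shifted-j ⟩
      0ℚ                                            ∎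
      where
      open ≡-Reasoning
      numerPolar∈K : InK numerPolar
      numerPolar∈K = InK-act x⁻ᵏ (InK-act p (InK-act Denom InK-δ))
      t-k<0 : + t ℤ.- + k ℤ.< + 0
      t-k<0 = subst₂ ℤ._<_ (ℤP.+-comm (ℤ.- + k) (+ t)) (ℤP.+-inverseˡ (+ k)) (ℤP.+-monoʳ-< (ℤ.- + k) (ℤ.+<+ t<k))
      shifted-j : lookup (subE m (0E [ j ]≔ + k)) j ≡ + t ℤ.- + k
      shifted-j = trans (lookup-subE m _ j) (cong₂ ℤ._-_ m-j (lookup∘update j 0E (+ k)))

    p-supported : ∀ t → t ℕ.≤ k → Supp≥ (+ t) (coeff p)
    p-supported zero _ = p-poly
    p-supported (suc t) t<k m p≢0 =
      ℤP.i<j⇒suc[i]≤j (ℤP.≤∧≢⇒< (p≥t m p≢0) (λ t≡m-j → p≢0 (p-on-degree t t<k p≥t m (sym t≡m-j))))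
      where
      p≥t : Supp≥ (+ t) (coeff p)
      p≥t = p-supported t (ℕP.<⇒≤ t<k)

    p≡0 : ∀ m → coeff p m ≡ 0ℚ
    p≡0 m = ≡0-stable _ (λ p≢0 → ℤP.<⇒≱ (p-deg m p≢0) (p-supported k ℕP.≤-refl m p≢0))

    numer-on-x⁰ : ∀ γ → lookup γ j ≡ + 0 → numer γ ≡ coeff P γ + sumℚ n (λ i → coeff (B i) γ)
    numer-on-x⁰ γ γ-j = cong₂ _+_ (trans (cong₂ _+_ poly polar) (ℚP.+-identityʳ (coeff P γ))) factors
      where
      poly : numerPoly γ ≡ coeff P γ
      poly = trans (act-local P den δ γ (λ m P≢0 → LowestTermOne-δ Denom Den-lowest (subE γ m)
                                                   (shift-from-x⁰-≤0 γ m γ-j (P-poly m P≢0))))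
                   (act-δ P γ)
      polar : numerPolar γ ≡ 0ℚ
      polar = trans (act-cong x⁻ᵏ (λ γ' → act-local-0 p den γ' (λ m p≢0 → contradiction (p≡0 m) p≢0)) γ)
                    (act-zeroʳ x⁻ᵏ γ)
      factors : numerFactors γ ≡ sumℚ n (λ i → coeff (B i) γ)
      factors = sumℚ-cong n λ i →
        trans (act-local (B i) (denExcept i) δ γ (λ m B≢0 → LowestTermOne-δ (DenomExcept i) (DenExcept-lowest i) (subE γ m)
                                                               (shift-from-x⁰-≤0 γ m γ-j (proj₁ (B-deg i) m B≢0))))
              (act-δ (B i) γ)

    D-Nm-on-x⁰ : ∀ β → lookup β j ≡ + 0 →
      coeff (D ⊗ Nm) β ≡ coeff (c ⊗ P) β + sumℚ n (λ i → coeff (c ⊗ B i) β)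
    D-Nm-on-x⁰ β β-j = begin
      coeff (D ⊗ Nm) β                                          ≡⟨ act-coeff D Nm β ⟨
      act D (coeff Nm) β                                        ≡⟨ D-Nm≡c-numer β ⟩
      act c numer β                                             ≡⟨ act-c-on-x⁰ numer _ β β-j numer-on-x⁰ ⟩
      act c (λ γ → coeff P γ + sumℚ n (λ i → coeff (B i) γ)) β  ≡⟨ act-c-+sumℚ (coeff P) (λ i → coeff (B i)) β ⟩
      act c (coeff P) β + sumℚ n (λ i → act c (coeff (B i)) β)  ≡⟨ cong₂ _+_ (act-coeff c P β) (sumℚ-cong n (λ i → act-coeff c (B i) β)) ⟩
      coeff (c ⊗ P) β + sumℚ n (λ i → coeff (c ⊗ B i) β)        ∎
      where open ≡-Reasoning

    constantTerm : ∀ β → lookup β j ≡ + 0 →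
      act (c ⊗ D) f β ≡ coeff (D ⊗ Nm) β - sumℚ n (λ i → χl i * coeff (c ⊗ B i) β)
    constantTerm β β-j = begin
      act (c ⊗ D) f β                                   ≡⟨ act-⊗ c D f β ⟩
      act c (act D f) β                                 ≡⟨ act-cong c D-f≡pfExpansion β ⟩
      act c pfExpansion β                               ≡⟨ act-c-on-x⁰ pfExpansion _ β β-j pfExpansion-on-x⁰ ⟩
      act c (λ γ → coeff P γ + sumℚ n (λ i → χs i * coeff (B i) γ)) β
                                                        ≡⟨ act-c-+sumℚ (coeff P) (λ i γ → χs i * coeff (B i) γ) β ⟩
      act c (coeff P) β + sumℚ n (λ i → act c (λ γ → χs i * coeff (B i) γ) β)
                                                        ≡⟨ cong₂ _+_ (act-coeff c P β) (sumℚ-cong n λ i →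
                                                             trans (act-* c (χs i) (coeff (B i)) β) (cong (χs i *_) (act-coeff c (B i) β))) ⟩
      X + ∑ (λ i → χs i * y i)                          ≡⟨ regroup X (∑ (λ i → χs i * y i)) (∑ (λ i → χl i * y i)) ⟩
      X + (∑ (λ i → χs i * y i) + ∑ (λ i → χl i * y i)) - ∑ (λ i → χl i * y i)
                                                        ≡⟨ cong (λ z → X + z - ∑ (λ i → χl i * y i)) (sumℚ-by-size y) ⟨
      X + ∑ y - ∑ (λ i → χl i * y i)                    ≡⟨ cong (_- ∑ (λ i → χl i * y i)) (D-Nm-on-x⁰ β β-j) ⟨
      coeff (D ⊗ Nm) β - ∑ (λ i → χl i * y i)           ∎
      where
      open ≡-Reasoning
      ∑ : (Fin n → ℚ) → ℚ
      ∑ = sumℚ n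
      X : ℚ
      X = coeff (c ⊗ P) β
      y : Fin n → ℚ
      y i = coeff (c ⊗ B i) β
      regroup : ∀ x s l → x + s ≡ x + (s + l) - l
      regroup = ℚ-solve 3 (λ x s l → x :+ s := x :+ (s :+ l) :- l) refl

  module ProperFraction (Nm-deg : DegLt j Nm (+ sumℕ n a)) where

    Fac-leading : ∀ i → LeadingMonomial (Fac j u a i) (a i)
    Fac-leading i =
      subst (LeadingMonomial (Fac j u a i)) (ℕP.suc-pred (a i)) (LeadingMonomial-OneMinus (M i) _ (M-j≡suc i))

    Den-leading : LeadingMonomial Denom (sumℕ n a)
    Den-leading = LeadingMonomial-prodP n (Fac j u a) a Fac-leading

    DenExcept-leading : ∀ i → LeadingMonomial (DenomExcept i) (sumℕ n (omit 0 i a))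
    DenExcept-leading i = LeadingMonomial-prodP n (omit one i (Fac j u a)) (omit 0 i a) (λ i' → leading (i FP.≟ i') i')
      where
      leading : ∀ {P : Set} (d : Dec P) i' →
        LeadingMonomial (if ⌊ d ⌋ then one else Fac j u a i') (if ⌊ d ⌋ then 0 else a i')
      leading (yes _) i' = LeadingMonomial-one
      leading (no _) i' = Fac-leading i'

    top : ℤ
    top = + sumℕ n a ℤ.- + 1

    above-top⇒0 : ∀ {F : Ser N} → Supp≤ top F → ∀ γ → + sumℕ n a ℤ.≤ lookup γ j → F γ ≡ 0ℚ
    above-top⇒0 F≤top γ ≥Σa = SuppIn-outside (ℤ._≤ top) F≤top γ
      (ℤP.<⇒≱ (ℤP.<-≤-trans (subst (top ℤ.<_) (i-j+j≡i (+ sumℕ n a) (+ 1)) (i<i+suc top 0)) ≥Σa))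

    D-Nm≤top : Supp≤ top (act D (coeff Nm))
    D-Nm≤top = subst (λ z → Supp≤ z (act D (coeff Nm))) (ℤP.+-identityʳ top)
      (act-Supp≤ D (+ 0) top (coeff Nm) (free⇒≤0 D D-free) (λ m Nm≢0 → i<j⇒i≤j-1 (Nm-deg m Nm≢0)))

    c-numerPolar≤top : Supp≤ top (act c numerPolar)
    c-numerPolar≤top = subst (λ z → Supp≤ z (act c numerPolar)) (degree (+ sumℕ n a) (+ k))
      (act-Supp≤ c (+ 0) _ numerPolar (free⇒≤0 c c-free)
        (act-Supp≤ x⁻ᵏ (ℤ.- + k) _ (act p den) x⁻ᵏ-degree
          (act-Supp≤ p (+ k ℤ.- + 1) _ den (λ m p≢0 → i<j⇒i≤j-1 (p-deg m p≢0))
            (LeadingMonomial-Supp≤ Denom (sumℕ n a) Den-leading (+ 0) δ Supp≤-δ))))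
      where
      degree : ∀ s k → + 0 ℤ.+ s ℤ.+ (k ℤ.- + 1) ℤ.+ ℤ.- k ℤ.+ + 0 ≡ s ℤ.- + 1
      degree = solve-∀
      x⁻ᵏ-degree : ∀ m → coeff x⁻ᵏ m ≢ 0ℚ → lookup m j ℤ.≤ ℤ.- + k
      x⁻ᵏ-degree m x⁻ᵏ≢0 with ≡-dec ℤ._≟_ (0E [ j ]≔ ℤ.- + k) m
      ... | yes refl = ℤP.≤-reflexive (lookup∘update j 0E (ℤ.- + k))
      ... | no _ = contradiction (ℚP.+-identityʳ 0ℚ) x⁻ᵏ≢0

    c-numerFactors≤top : Supp≤ top (act c numerFactors)
    c-numerFactors≤top = subst (λ z → Supp≤ z (act c numerFactors)) (ℤP.+-identityʳ top)
      (act-Supp≤ c (+ 0) top numerFactors (free⇒≤0 c c-free)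
        (SuppIn-sumℚ (ℤ._≤ top) n (λ i → act (B i) (denExcept i)) factor≤top))
      where
      degree : ∀ d a → + 0 ℤ.+ d ℤ.+ (a ℤ.- + 1) ≡ d ℤ.+ a ℤ.- + 1
      degree = solve-∀
      factor≤top : ∀ i → Supp≤ top (act (B i) (denExcept i))
      factor≤top i = subst (λ z → Supp≤ z (act (B i) (denExcept i)))
        (trans (degree (+ sumℕ n (omit 0 i a)) (+ a i))
               (cong (ℤ._- + 1) (trans (sym (ℤP.pos-+ (sumℕ n (omit 0 i a)) (a i))) (cong +_ (sumℕ-omit n a i)))))
        (act-Supp≤ (B i) (+ a i ℤ.- + 1) _ (denExcept i) (λ m B≢0 → i<j⇒i≤j-1 (proj₂ (B-deg i) m B≢0))
          (LeadingMonomial-Supp≤ (DenomExcept i) _ (DenExcept-leading i) (+ 0) δ Supp≤-δ))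

    -- In x-degree ≥ Σ a_i the other two parts of the numerator and D Nm vanish.
    c-numerPoly-above : ∀ γ → + sumℕ n a ℤ.≤ lookup γ j → act c numerPoly γ ≡ 0ℚ
    c-numerPoly-above γ ≥Σa = begin
      act c numerPoly γ                                            ≡⟨ pad (act c numerPoly γ) ⟩
      act c numerPoly γ + 0ℚ + 0ℚ                                  ≡⟨ cong₂ _+_ (+-congˡ (act c numerPoly γ)
                                                                        (sym (above-top⇒0 c-numerPolar≤top γ ≥Σa)))
                                                                        (sym (above-top⇒0 c-numerFactors≤top γ ≥Σa)) ⟩
      act c numerPoly γ + act c numerPolar γ + act c numerFactors γ ≡⟨ numer-split γ ⟨
      act c numer γ                                                ≡⟨ D-Nm≡c-numer γ ⟨
      act D (coeff Nm) γ                                           ≡⟨ above-top⇒0 D-Nm≤top γ ≥Σa ⟩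
      0ℚ                                                           ∎
      where
      open ≡-Reasoning
      pad : ∀ x → x ≡ x + 0ℚ + 0ℚ
      pad = ℚ-solve 1 (λ x → x := x :+ con 0ℚ :+ con 0ℚ) refl

    degreeBound : List (Exp N) → ℕ
    degreeBound [] = 0
    degreeBound (m ∷ ms) = ℤ.∣ lookup m j ∣ ℕ.⊔ degreeBound ms

    degreeBound-≥ : ∀ ms m → m ∈ ms → lookup m j ℤ.≤ + degreeBound ms
    degreeBound-≥ (m ∷ ms) .m (here refl) =
      ℤP.≤-trans (i≤+∣i∣ (lookup m j)) (ℤ.+≤+ (ℕP.m≤m⊔n _ (degreeBound ms)))
      where
      i≤+∣i∣ : ∀ i → i ℤ.≤ + ℤ.∣ i ∣
      i≤+∣i∣ (+ _) = ℤP.≤-refl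
      i≤+∣i∣ -[1+ _ ] = ℤ.-≤+
    degreeBound-≥ (m' ∷ ms) m (there m∈ms) =
      ℤP.≤-trans (degreeBound-≥ ms m m∈ms) (ℤ.+≤+ (ℕP.m≤n⊔m ℤ.∣ lookup m' j ∣ (degreeBound ms)))

    P≤bound : Supp≤ (+ degreeBound (L.map proj₂ P)) (coeff P)
    P≤bound m P≢0 = degreeBound-≥ _ m (coeff≢0⇒∈ P m P≢0)

    -- The top x-degree part of P, times the leading monomial of the denominator, is a part
    -- of c numerPoly in degree ≥ Σ a_i, hence zero.
    P-top-degree : ∀ s → Supp≤ s (coeff P) → ∀ m → lookup m j ≡ s → coeff P m ≡ 0ℚ
    P-top-degree s P≤s m m-j = ≡0-stable _ λ P≢0 →
      P≢0 (LeadingMonomial-top-slice Denom (sumℕ n a) Den-leading s (coeff P) P≤s (Den-P≡0 (0≤s P≢0)) m m-j)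
      where
      numerPoly∈K : InK numerPoly
      numerPoly∈K = InK-act P (InK-act Denom InK-δ)
      0≤s : coeff P m ≢ 0ℚ → + 0 ℤ.≤ s
      0≤s P≢0 = subst (+ 0 ℤ.≤_) m-j (P-poly m P≢0)
      Den-P≡0 : + 0 ℤ.≤ s → ∀ γ → lookup γ j ≡ s ℤ.+ + sumℕ n a → act Denom (coeff P) γ ≡ 0ℚ
      Den-P≡0 0≤s γ γ-j = begin
        act Denom (coeff P) γ  ≡⟨ act-cong Denom (act-δ P) γ ⟨
        act Denom (act P δ) γ  ≡⟨ act-comm P Denom δ γ ⟨
        numerPoly γ            ≡⟨ act≡0⇒≡0-onSlice c c-free c≢0 numerPoly numerPoly∈K (s ℤ.+ + sumℕ n a)
                                    (λ γ' γ'-j → c-numerPoly-above γ' (subst (+ sumℕ n a ℤ.≤_) (sym γ'-j) Σa≤))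
                                    γ γ-j ⟩
        0ℚ                     ∎
        where
        open ≡-Reasoning
        Σa≤ : + sumℕ n a ℤ.≤ s ℤ.+ + sumℕ n a
        Σa≤ = subst (ℤ._≤ s ℤ.+ + sumℕ n a) (ℤP.+-identityˡ (+ sumℕ n a)) (ℤP.+-monoˡ-≤ (+ sumℕ n a) 0≤s)

    P-supported-below : ∀ r → Supp≤ (+ degreeBound (L.map proj₂ P) ℤ.- + r) (coeff P)
    P-supported-below zero = subst (λ z → Supp≤ z (coeff P)) (sym (ℤP.+-identityʳ _)) P≤bound
    P-supported-below (suc r) m P≢0 =
      subst (lookup m j ℤ.≤_) (step (+ degreeBound (L.map proj₂ P)) (+ r))
        (i<j⇒i≤j-1 (ℤP.≤∧≢⇒< (P≤s m P≢0) (λ m-j≡s → P≢0 (P-top-degree _ P≤s m m-j≡s))))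
      where
      P≤s : Supp≤ (+ degreeBound (L.map proj₂ P) ℤ.- + r) (coeff P)
      P≤s = P-supported-below r
      step : ∀ b r → b ℤ.- r ℤ.- + 1 ≡ b ℤ.- (+ 1 ℤ.+ r)
      step = solve-∀

    P≡0 : ∀ m → coeff P m ≡ 0ℚ
    P≡0 m = ≡0-stable _ λ P≢0 → ℤP.<⇒≱ (below P≢0) (P-poly m P≢0)
      where
      bound : ℕ
      bound = degreeBound (L.map proj₂ P)
      below : coeff P m ≢ 0ℚ → lookup m j ℤ.< + 0
      below P≢0 = ℤP.≤-<-trans (P-supported-below (suc bound) m P≢0)
                    (subst (ℤ._< + 0) (sym (trans (cong (λ z → + bound ℤ.- z) (ℤP.pos-+ 1 bound)) (bound-gap (+ bound)))) ℤ.-<+)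
        where
        bound-gap : ∀ b → b ℤ.- (+ 1 ℤ.+ b) ≡ ℤ.- + 1
        bound-gap = solve-∀

    constantTerm : ∀ β → lookup β j ≡ + 0 → act D f β ≡ sumℚ n (λ i → χs i * coeff (B i) β)
    constantTerm β β-j = begin
      act D f β                                             ≡⟨ D-f≡pfExpansion β ⟩
      pfExpansion β                                         ≡⟨ pfExpansion-on-x⁰ β β-j ⟩
      coeff P β + sumℚ n (λ i → χs i * coeff (B i) β)       ≡⟨ cong (_+ sumℚ n (λ i → χs i * coeff (B i) β)) (P≡0 β) ⟩
      0ℚ + sumℚ n (λ i → χs i * coeff (B i) β)              ≡⟨ ℚP.+-identityˡ _ ⟩
      sumℚ n (λ i → χs i * coeff (B i) β)                   ∎
      where open ≡-Reasoning

lemma4p1 : ∀ {N : ℕ} (j : Fin N) (n : ℕ) (u : Fin n → Exp N) (a : Fin n → ℕ) →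
    (∀ i → lookup (u i) j ≡ + 0) →
    (∀ i → 1 ℕ.≤ a i) →
    (∀ i i' → i ≢ i' → CoprimeIn j (Fac j u a i) (Fac j u a i')) →
    (Nm c : LPoly N) → FreeOf j c → Nonzero c →
    (f : Ser N) → IsExpansion j n u a Nm c f →
    (D : LPoly N) (k : ℕ) (P p : LPoly N) (B : Fin n → LPoly N) →
    IsPartialFraction j n u a Nm c D k P p B →
    (DegLt j Nm (+ sumℕ n a) →
       ∀ β → lookup β j ≡ + 0 →
         act D f β ≡ sumℚ n (λ i → χ (isSmall (uxa j u a i)) ℚ.* coeff (B i) β))
    ×
    (PolyIn j Nm →
       ∀ β → lookup β j ≡ + 0 →
         act (c ⊗ D) f β ≡
           coeff (D ⊗ Nm) β ℚ.- sumℚ n (λ i → χ (isLarge (uxa j u a i)) ℚ.* coeff (c ⊗ B i) β))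
lemma4p1 j n u a _ a≥1 _ Nm c c-free c≢0 f (f∈K , f-expands) D k P p B
         (D-free , _ , P-poly , p-poly , p-deg , B-deg , partial-fractions) =
  ProperFraction.constantTerm , PolynomialNumerator.constantTerm
  where
  open ConstantTerm j n u a a≥1 Nm c c-free c≢0 f f∈K f-expands D k P p B
                    D-free P-poly p-poly p-deg B-deg partial-fractions
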